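{- (a) For all integers $n \geq 2$, $(47n+140)/176 \leq p_{5,16}(f_{5,0}(n)) \leq (15n-11)/4$. The lower bound is attained precisely when $(n)_{16} \in d_{11}^{\,*}\, d_{12}$, and the upper bound precisely when $(n)_{16} \in \{1,5\} \cup 4\,4^*\,5$. (b) For all integers $n \geq 2$, $\big((47n+140)/176\big)^{\frac{\log 5}{\log 16}} \leq f_{5,0}(n) \leq \big((225n-165)/16\big)^{\frac{\log 5}{\log 16}}$.
   Context: Let $t(n)$ be the number of $1$'s in the base-$2$ representation of $n$, taken modulo $2$. Define $f_{5,0}(n) = \sum_{0 \leq i < n} (-1)^{t(5i)}$ for $n \geq 0$. For an integer $c \geq 2$, $(n)_c$ is the base-$c$ representation of $n\ge0$ (most significant digit first, no leading zeros), a word over digits $\{0,\ldots,c-1\}$; for a digit word $x = a_1\cdots a_t$, $[x]_c = \sum_{i=1}^t a_i c^{t-i}$. Define $p_{5,16}(m) = [(m)_5]_{16}$ for $m \geq 0$. In the regular expressions, $d_{11}$ and $d_{12}$ denote the single base-16 digits with values $11$ and $12$, the symbols $1,4,5$ denote single base-16 digits, $^*$ is Kleene star and juxtaposition is concatenation. -}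

module Defs where

open import Data.Nat using (ℕ; zero; suc; _+_; _*_; _^_; NonZero)
open import Data.Nat.DivMod using (_/_; _%_)
open import Data.List using (List; []; _∷_; _++_; [_]; foldl; map; upTo)
open import Data.Nat.ListAction using (sum)
open import Data.Integer using (ℤ; +_; -[1+_])
import Data.Integer as ℤ
open import Data.Rational using (ℚ; 0ℚ; 1ℚ; _<_)
import Data.Rational as ℚ
open import Data.Product using (_×_; ∃)
open import Data.Sum using (_⊎_)
open import Relation.Binary.PropositionalEquality using (_≡_)
open import Data.List using (replicate)

-- base-c digits (most significant first, no leading zeros; (0)_c = empty word)
digitsAux : (c : ℕ) → .{{NonZero c}} → ℕ → ℕ → List ℕ
digitsAux c zero n = []
digitsAux c (suc fuel) zero = []
digitsAux c (suc fuel) (suc n) = digitsAux c fuel (suc n / c) ++ [ suc n % c ]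

digits : (c : ℕ) → .{{NonZero c}} → ℕ → List ℕ
digits c n = digitsAux c n n

evalDigits : ℕ → List ℕ → ℕ
evalDigits c = foldl (λ acc d → acc * c + d) 0

t : ℕ → ℕ
t n = sum (digits 2 n) % 2

signPow : ℕ → ℤ
signPow k with k % 2
... | zero = + 1
... | suc _ = -[1+ 0 ]

sumℤ : List ℤ → ℤ
sumℤ = foldl ℤ._+_ (+ 0)

f50 : ℕ → ℤ
f50 n = sumℤ (map (λ i → signPow (t (5 * i))) (upTo n))

p516 : ℕ → ℕ
p516 m = evalDigits 16 (digits 5 m)

InLowLang : List ℕ → Set
InLowLang w = ∃ λ k → w ≡ replicate k 11 ++ [ 12 ]

InHighLang : List ℕ → Set
InHighLang w = (w ≡ [ 1 ]) ⊎ (w ≡ [ 5 ]) ⊎ (∃ λ k → w ≡ 4 ∷ replicate k 4 ++ [ 5 ])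

powℚ : ℚ → ℕ → ℚ
powℚ x zero = 1ℚ
powℚ x (suc k) = x ℚ.* powℚ x k

ℕtoℚ : ℕ → ℚ
ℕtoℚ n = + n ℚ./ 1

-- α = log 5 / log 16.  For x, y > 0:
-- "x^α ≤ y"  ⟺  log_16 x ≤ log_5 y
--            ⟺  ∀ rational r = (a - b)/q (q ≥ 1): log_5 y < r → log_16 x < r
--            ⟺  ∀ a b q: y^q·5^b < 5^a → x^q·16^b < 16^a
PowαLe : ℚ → ℚ → Set
PowαLe x y = (0ℚ < x) × (0ℚ < y) ×
  (∀ a b q → powℚ y (suc q) ℚ.* ℕtoℚ (5 ^ b) < ℕtoℚ (5 ^ a)
           → powℚ x (suc q) ℚ.* ℕtoℚ (16 ^ b) < ℕtoℚ (16 ^ a))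

-- "y ≤ x^α"  ⟺  log_5 y ≤ log_16 x
--            ⟺  ∀ a b q: x^q·16^b < 16^a → y^q·5^b < 5^a
LePowα : ℚ → ℚ → Set
LePowα y x = (0ℚ < x) × (0ℚ < y) ×
  (∀ a b q → powℚ x (suc q) ℚ.* ℕtoℚ (16 ^ b) < ℕtoℚ (16 ^ a)
           → powℚ y (suc q) ℚ.* ℕtoℚ (5 ^ b) < ℕtoℚ (5 ^ a))

-- Let T = tmSum be the partial sums of the Thue–Morse signs sgn.  Cutting the sum defining
-- f (16 n + r) into blocks of sixteen gives f (16 n + r) = 5 f n + D, where D depends only on r and on
-- the values T (5 n), sgn (5 n), …, sgn (5 n + 4); these values follow the hexadecimal digits of n
-- through a twelve-state automaton, and |D| ≤ 7.  Writing f (16 n + r) + k = 5 (f n + k′) + d with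
-- a base-5 digit d and carries k, k′ ∈ [-2, 1], the map p516 turns this into Y = 16 Y′ + d, so a
-- linear form α Y − β n is multiplied by 16 up to a constant at each digit.  Tables of lower bounds
-- for such forms, indexed by state and carry and checked by evaluation, give both inequalities of
-- (a) with their cases of equality.  For (b), cut n to its two leading hexadecimal digits a,
-- n ≈ 16 ^ j a: then 4 f n ∓ 7 lies beyond 5 ^ j (4 f a ∓ 7), and for each of the finitely many a a
-- rational exponent θ is found with (47 n + 140) / 176 ≤ 16 ^ θ and 5 ^ θ ≤ f n, and likewise for
-- the upper bound.

module Submission where

open import Defs
open import Data.Bool.Base using (Bool; T; _∧_)
open import Data.Empty using (⊥-elim)
open import Data.Fin.Base using (Fin; toℕ)
open import Data.Fin using (#_)
import Data.Fin.Properties as Fin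
open import Data.Integer.Base as ℤ using (ℤ; +_; -[1+_]; ∣_∣; 0ℤ; 1ℤ; -1ℤ)
import Data.Integer as ℤ using (_≟_; _≤?_; _<?_)
open import Data.Integer.DivMod using (_/ℕ_; _%ℕ_; a≡a%ℕn+[a/ℕn]*n; n%ℕd<d)
open import Data.Integer.GCD using (gcd)
import Data.Integer.Properties as ℤₚ
open import Algebra.Properties.AbelianGroup ℤₚ.+-0-abelianGroup using (∙-cancelʳ)
open import Data.Integer.Tactic.RingSolver as ℤ-Solver using ()
open import Data.List.Base using (List; []; _∷_; _++_; [_]; foldl; map; upTo; replicate)
open import Data.List.Properties using (foldl-++; upTo-∷ʳ; map-++; ∷ʳ-injective)
open import Data.Nat.Base hiding (_/_)
open import Data.Nat.DivMod hiding (_/_)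
open import Data.Nat.Divisibility using (divides-refl)
open import Data.Nat.Induction using (<-rec)
open import Data.Nat.ListAction using (sum)
open import Data.Nat.ListAction.Properties using (sum-++)
open import Data.Nat.Properties
open import Data.Nat.Tactic.RingSolver using (solve-∀)
open import Data.Product.Base using (_×_; _,_; proj₁; proj₂; ∃)
open import Data.Rational.Base as ℚ using (ℚ; 0ℚ; ↥_; ↧_; _/_)
import Data.Rational.Properties as ℚₚ
open import Data.Sum.Base using (_⊎_; inj₁; inj₂)
open import Data.Vec.Base using (Vec; []; _∷_; lookup)
open import Function.Base using (_∘_)
open import Function.Bundles using (_⇔_; mk⇔; Equivalence)
open import Function.Construct.Composition using (_⇔-∘_)
open import Function.Construct.Symmetry using (⇔-sym)
open import Relation.Binary.PropositionalEquality hiding ([_])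
open import Relation.Nullary.Decidable using (Dec; yes; no; does; from-yes; _×-dec_; _→-dec_; T?)

-- Digits

module _ (b : ℕ) .{{_ : NonZero b}} (1<b : 1 < b) where

  digitsAux-zero : ∀ F → digitsAux b F 0 ≡ []
  digitsAux-zero zero    = refl
  digitsAux-zero (suc F) = refl

  digitsAux-fuel : ∀ F G n → n ≤ F → n ≤ G → digitsAux b F n ≡ digitsAux b G n
  digitsAux-fuel F G zero _ _ = trans (digitsAux-zero F) (sym (digitsAux-zero G))
  digitsAux-fuel (suc F) (suc G) (suc n) (s≤s n≤F) (s≤s n≤G) =
    cong (_++ [ suc n % b ]) (digitsAux-fuel F G (suc n div b) (quotient≤ n≤F) (quotient≤ n≤G))
    where
    quotient≤ : ∀ {X} → n ≤ X → suc n div b ≤ X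
    quotient≤ n≤X = ≤-pred (≤-trans (m/n<m (suc n) b 1<b) (s≤s n≤X))

  digits-pos : ∀ {n} → 0 < n → digits b n ≡ digits b (n div b) ++ [ n % b ]
  digits-pos {suc n} _ = cong (_++ [ suc n % b ])
    (digitsAux-fuel n (suc n div b) (suc n div b) (≤-pred (m/n<m (suc n) b 1<b)) ≤-refl)

  digits-snoc : ∀ a d → d < b → 0 < d + a * b → digits b (d + a * b) ≡ digits b a ++ [ d ]
  digits-snoc a d d<b 0<n = trans (digits-pos 0<n) (cong₂ (λ x y → digits b x ++ [ y ]) quotient remainder)
    where
    quotient : (d + a * b) div b ≡ a
    quotient = trans (+-distrib-/-∣ʳ d (divides-refl a)) (cong₂ _+_ (m<n⇒m/n≡0 d<b) (m*n/n≡m a b))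
    remainder : (d + a * b) % b ≡ d
    remainder = trans ([m+kn]%n≡m%n d a b) (m<n⇒m%n≡m d<b)

  digits-digit : ∀ {d} → 0 < d → d < b → digits b d ≡ [ d ]
  digits-digit {d} 0<d d<b = subst (λ n → digits b n ≡ [ d ]) (+-identityʳ d)
    (digits-snoc 0 d d<b (subst (0 <_) (sym (+-identityʳ d)) 0<d))

  digits-unsnoc : ∀ n xs d → digits b n ≡ xs ++ [ d ] → digits b (n div b) ≡ xs × n % b ≡ d
  digits-unsnoc zero    []      d ()
  digits-unsnoc zero    (_ ∷ _) d ()
  digits-unsnoc (suc n) xs      d eq = ∷ʳ-injective _ xs (trans (sym (digits-pos z<s)) eq)

  digits≡[]⇒≡0 : ∀ n → digits b n ≡ [] → n ≡ 0
  digits≡[]⇒≡0 zero    _  = refl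
  digits≡[]⇒≡0 (suc n) eq with digits b (suc n div b) | trans (sym (digits-pos z<s)) eq
  ... | []    | ()
  ... | _ ∷ _ | ()

  evalDigits-digits-snoc⁺ : ∀ c a d → d < b → 0 < d + a * b →
                            evalDigits c (digits b (d + a * b)) ≡ d + evalDigits c (digits b a) * c
  evalDigits-digits-snoc⁺ c a d d<b pos = begin
    evalDigits c (digits b (d + a * b))       ≡⟨ cong (evalDigits c) (digits-snoc a d d<b pos) ⟩
    evalDigits c (digits b a ++ [ d ])        ≡⟨ foldl-++ (λ acc x → acc * c + x) 0 (digits b a) [ d ] ⟩
    evalDigits c (digits b a) * c + d         ≡⟨ +-comm _ d ⟩
    d + evalDigits c (digits b a) * c         ∎
    where open ≡-Reasoning

  evalDigits-digits-snoc : ∀ c a d → d < b →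
                           evalDigits c (digits b (d + a * b)) ≡ d + evalDigits c (digits b a) * c
  evalDigits-digits-snoc c zero    zero    _   = refl
  evalDigits-digits-snoc c a       (suc d) d<b = evalDigits-digits-snoc⁺ c a (suc d) d<b z<s
  evalDigits-digits-snoc c (suc a) zero    d<b =
    evalDigits-digits-snoc⁺ c (suc a) zero d<b (≤-trans (>-nonZero⁻¹ b) (m≤m+n b (a * b)))

  digit-induction : (P : ℕ → Set) → P 0 → (∀ {r n} → r < b → P n → P (r + n * b)) → ∀ n → P n
  digit-induction P P0 step = <-rec P go
    where
    go : ∀ n → (∀ {m} → m < n → P m) → P n
    go zero    _   = P0
    go (suc n) rec = subst P (sym (m≡m%n+[m/n]*n (suc n) b))
      (step (m%n<n (suc n) b) (rec (m/n<m (suc n) b 1<b)))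

-- Thue–Morse signs

bitSum : ℕ → ℕ
bitSum n = sum (digits 2 n)

sgn : ℕ → ℤ
sgn n = -1ℤ ℤ.^ bitSum n

-1^-even : ∀ q → -1ℤ ℤ.^ (q * 2) ≡ 1ℤ
-1^-even zero    = refl
-1^-even (suc q) = cong (λ x → -1ℤ ℤ.* (-1ℤ ℤ.* x)) (-1^-even q)

-1^-mod2 : ∀ k → -1ℤ ℤ.^ (k % 2) ≡ -1ℤ ℤ.^ k
-1^-mod2 k = sym (begin
  -1ℤ ℤ.^ k                                     ≡⟨ cong (-1ℤ ℤ.^_) (m≡m%n+[m/n]*n k 2) ⟩
  -1ℤ ℤ.^ (k % 2 + k div 2 * 2)                 ≡⟨ ℤₚ.^-distribˡ-+-* -1ℤ (k % 2) (k div 2 * 2) ⟩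
  -1ℤ ℤ.^ (k % 2) ℤ.* -1ℤ ℤ.^ (k div 2 * 2)     ≡⟨ cong (-1ℤ ℤ.^ (k % 2) ℤ.*_) (-1^-even (k div 2)) ⟩
  -1ℤ ℤ.^ (k % 2) ℤ.* 1ℤ                        ≡⟨ ℤₚ.*-identityʳ _ ⟩
  -1ℤ ℤ.^ (k % 2)                               ∎)
  where open ≡-Reasoning

signPow≡-1^ : ∀ k → signPow k ≡ -1ℤ ℤ.^ k
signPow≡-1^ k with k % 2 in eq
... | zero          = trans (cong (-1ℤ ℤ.^_) (sym eq)) (-1^-mod2 k)
... | suc zero      = trans (cong (-1ℤ ℤ.^_) (sym eq)) (-1^-mod2 k)
... | suc (suc _)   = ⊥-elim (<⇒≱ (m%n<n k 2) (subst (2 ≤_) (sym eq) (s≤s (s≤s z≤n))))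

bitSum-snoc⁺ : ∀ a d → d < 2 → 0 < d + a * 2 → bitSum (d + a * 2) ≡ bitSum a + d
bitSum-snoc⁺ a d d<2 pos = begin
  sum (digits 2 (d + a * 2))      ≡⟨ cong sum (digits-snoc 2 (s≤s (s≤s z≤n)) a d d<2 pos) ⟩
  sum (digits 2 a ++ [ d ])       ≡⟨ sum-++ (digits 2 a) [ d ] ⟩
  bitSum a + (d + 0)              ≡⟨ cong (λ x → bitSum a + x) (+-identityʳ d) ⟩
  bitSum a + d                    ∎
  where open ≡-Reasoning

signPow-t : ∀ n → signPow (t n) ≡ sgn n
signPow-t n = trans (signPow≡-1^ (t n)) (-1^-mod2 (bitSum n))

bitSum-snoc : ∀ a d → d < 2 → bitSum (d + a * 2) ≡ bitSum a + d
bitSum-snoc zero    zero    _   = refl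
bitSum-snoc a       (suc d) d<2 = bitSum-snoc⁺ a (suc d) d<2 z<s
bitSum-snoc (suc a) zero    d<2 = bitSum-snoc⁺ (suc a) zero d<2 z<s

bitSum-concat : ∀ k a s → s < 2 ^ k → bitSum (s + a * 2 ^ k) ≡ bitSum a + bitSum s
bitSum-concat zero    a zero    _ = trans (cong bitSum (*-identityʳ a)) (sym (+-identityʳ _))
bitSum-concat zero    a (suc s) (s≤s ())
bitSum-concat (suc k) a s s<2^k+1 = begin
  bitSum (s + a * 2 ^ suc k)                   ≡⟨ cong bitSum (regroup s a) ⟩
  bitSum (s % 2 + (s div 2 + a * 2 ^ k) * 2)   ≡⟨ bitSum-snoc (s div 2 + a * 2 ^ k) (s % 2) (m%n<n s 2) ⟩
  bitSum (s div 2 + a * 2 ^ k) + s % 2         ≡⟨ cong (_+ s % 2) (bitSum-concat k a (s div 2) s/2<2^k) ⟩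
  bitSum a + bitSum (s div 2) + s % 2          ≡⟨ +-assoc (bitSum a) _ _ ⟩
  bitSum a + (bitSum (s div 2) + s % 2)        ≡⟨ cong (λ x → bitSum a + x) (bitSum-snoc (s div 2) (s % 2) (m%n<n s 2)) ⟨
  bitSum a + bitSum (s % 2 + s div 2 * 2)      ≡⟨ cong (λ x → bitSum a + bitSum x) (m≡m%n+[m/n]*n s 2) ⟨
  bitSum a + bitSum s                          ∎
  where
  open ≡-Reasoning
  s/2<2^k : s div 2 < 2 ^ k
  s/2<2^k = m<n*o⇒m/o<n (subst (s <_) (*-comm 2 (2 ^ k)) s<2^k+1)
  regroup : ∀ s a → s + a * 2 ^ suc k ≡ s % 2 + (s div 2 + a * 2 ^ k) * 2
  regroup s a = trans (cong (_+ a * 2 ^ suc k) (m≡m%n+[m/n]*n s 2)) (ring (s % 2) (s div 2) a (2 ^ k))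
    where
    ring : ∀ r q a p → r + q * 2 + a * (2 * p) ≡ r + (q + a * p) * 2
    ring = solve-∀

sgn-concat : ∀ k a s → s < 2 ^ k → sgn (s + a * 2 ^ k) ≡ sgn a ℤ.* sgn s
sgn-concat k a s s<2^k =
  trans (cong (-1ℤ ℤ.^_) (bitSum-concat k a s s<2^k)) (ℤₚ.^-distribˡ-+-* -1ℤ (bitSum a) (bitSum s))

sgn-split : ∀ M i → sgn (M * 16 + i) ≡ sgn (M + i div 16) ℤ.* sgn (i % 16)
sgn-split M i = trans (cong sgn regroup) (sgn-concat 4 (M + i div 16) (i % 16) (m%n<n i 16))
  where
  regroup : M * 16 + i ≡ i % 16 + (M + i div 16) * 16
  regroup = trans (cong (λ x → M * 16 + x) (m≡m%n+[m/n]*n i 16)) (ring M (i % 16) (i div 16))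
    where
    ring : ∀ M r q → M * 16 + (r + q * 16) ≡ r + (M + q) * 16
    ring = solve-∀

sumBelow : (ℕ → ℤ) → ℕ → ℤ
sumBelow g zero    = 0ℤ
sumBelow g (suc n) = sumBelow g n ℤ.+ g n

sumBelow-+ : ∀ g m k → sumBelow g (m + k) ≡ sumBelow g m ℤ.+ sumBelow (λ i → g (m + i)) k
sumBelow-+ g m zero    = trans (cong (sumBelow g) (+-identityʳ m)) (sym (ℤₚ.+-identityʳ _))
sumBelow-+ g m (suc k) = begin
  sumBelow g (m + suc k)                                          ≡⟨ cong (sumBelow g) (+-suc m k) ⟩
  sumBelow g (m + k) ℤ.+ g (m + k)                                ≡⟨ cong (ℤ._+ g (m + k)) (sumBelow-+ g m k) ⟩
  sumBelow g m ℤ.+ sumBelow (λ i → g (m + i)) k ℤ.+ g (m + k)     ≡⟨ ℤₚ.+-assoc (sumBelow g m) _ _ ⟩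
  sumBelow g m ℤ.+ sumBelow (λ i → g (m + i)) (suc k)             ∎
  where open ≡-Reasoning

sumBelow-cong : ∀ {g h} k → (∀ {i} → i < k → g i ≡ h i) → sumBelow g k ≡ sumBelow h k
sumBelow-cong zero    _  = refl
sumBelow-cong (suc k) eq = cong₂ ℤ._+_ (sumBelow-cong k (λ i<k → eq (m<n⇒m<1+n i<k))) (eq ≤-refl)

f : ℕ → ℤ
f = sumBelow (λ i → sgn (5 * i))

tmSum : ℕ → ℤ
tmSum = sumBelow sgn

f50≡f : ∀ n → f50 n ≡ f n
f50≡f zero    = refl
f50≡f (suc n) = begin
  sumℤ (map ε (upTo (suc n)))             ≡⟨ cong (λ l → sumℤ (map ε l)) (sym (upTo-∷ʳ n)) ⟩
  sumℤ (map ε (upTo n ++ [ n ]))          ≡⟨ cong sumℤ (map-++ ε (upTo n) [ n ]) ⟩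
  sumℤ (map ε (upTo n) ++ [ ε n ])        ≡⟨ foldl-++ ℤ._+_ 0ℤ (map ε (upTo n)) [ ε n ] ⟩
  f50 n ℤ.+ ε n                           ≡⟨ cong₂ ℤ._+_ (f50≡f n) (signPow-t (5 * n)) ⟩
  f (suc n)                               ∎
  where
  open ≡-Reasoning
  ε : ℕ → ℤ
  ε i = signPow (t (5 * i))

tmSum-even : ∀ M → tmSum (M * 2) ≡ 0ℤ
tmSum-even zero    = refl
tmSum-even (suc M) = begin
  tmSum (M * 2) ℤ.+ sgn (0 + M * 2) ℤ.+ sgn (1 + M * 2)
    ≡⟨ cong₂ (λ x y → tmSum (M * 2) ℤ.+ x ℤ.+ y) (sgn-concat 1 M 0 (s≤s z≤n)) (sgn-concat 1 M 1 (s≤s (s≤s z≤n))) ⟩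
  tmSum (M * 2) ℤ.+ sgn M ℤ.* 1ℤ ℤ.+ sgn M ℤ.* -1ℤ      ≡⟨ ring (tmSum (M * 2)) (sgn M) ⟩
  tmSum (M * 2)                                        ≡⟨ tmSum-even M ⟩
  0ℤ                                                   ∎
  where
  open ≡-Reasoning
  ring : ∀ T x → T ℤ.+ x ℤ.* 1ℤ ℤ.+ x ℤ.* -1ℤ ≡ T
  ring = ℤ-Solver.solve-∀

-- Recurrences along hexadecimal digits

window : ℕ → ℕ → ℤ
window n q = sgn (5 * n + q)

nextTmSum : (ℕ → ℤ) → ℕ → ℤ
nextTmSum w r = sumBelow (λ i → w (i div 16) ℤ.* sgn (i % 16)) (5 * r)

nextWindow : (ℕ → ℤ) → ℕ → ℕ → ℤ
nextWindow w r q = w ((5 * r + q) div 16) ℤ.* sgn ((5 * r + q) % 16)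

increment : ℤ → (ℕ → ℤ) → ℕ → ℤ
increment T w r = ℤ.- T ℤ.+ sumBelow (λ j → w (5 * j div 16) ℤ.* sgn (5 * j % 16)) r

sgn-5*-split : ∀ n j → sgn (5 * (n * 16 + j)) ≡ window n (5 * j div 16) ℤ.* sgn (5 * j % 16)
sgn-5*-split n j = trans (cong sgn (ring n j)) (sgn-split (5 * n) (5 * j))
  where
  ring : ∀ n j → 5 * (n * 16 + j) ≡ 5 * n * 16 + 5 * j
  ring = solve-∀

-- sgn (5 j mod 16) for j = 0, …, 15 reads + + + + − + − + − − − − + − + −
block-identity : ∀ w → sumBelow (λ j → w (5 * j div 16) ℤ.* sgn (5 * j % 16)) 16 ≡ + 5 ℤ.* w 0 ℤ.- sumBelow w 5
block-identity w = identity (w 0) (w 1) (w 2) (w 3) (w 4)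
  where
  identity : ∀ a b c d e →
    0ℤ ℤ.+ a ℤ.* 1ℤ ℤ.+ a ℤ.* 1ℤ ℤ.+ a ℤ.* 1ℤ ℤ.+ a ℤ.* 1ℤ
       ℤ.+ b ℤ.* -1ℤ ℤ.+ b ℤ.* 1ℤ ℤ.+ b ℤ.* -1ℤ ℤ.+ c ℤ.* 1ℤ ℤ.+ c ℤ.* -1ℤ ℤ.+ c ℤ.* -1ℤ
       ℤ.+ d ℤ.* -1ℤ ℤ.+ d ℤ.* -1ℤ ℤ.+ d ℤ.* 1ℤ ℤ.+ e ℤ.* -1ℤ ℤ.+ e ℤ.* 1ℤ ℤ.+ e ℤ.* -1ℤ
    ≡ + 5 ℤ.* a ℤ.- (0ℤ ℤ.+ a ℤ.+ b ℤ.+ c ℤ.+ d ℤ.+ e)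
  identity = ℤ-Solver.solve-∀

f-16 : ∀ n → f (n * 16) ≡ + 5 ℤ.* f n ℤ.- tmSum (5 * n)
f-16 zero    = refl
f-16 (suc n) = begin
  f (16 + n * 16)
    ≡⟨ trans (cong f (+-comm 16 (n * 16))) (sumBelow-+ _ (n * 16) 16) ⟩
  f (n * 16) ℤ.+ sumBelow (λ j → sgn (5 * (n * 16 + j))) 16
    ≡⟨ cong₂ ℤ._+_ (f-16 n) (sumBelow-cong 16 (λ {j} _ → sgn-5*-split n j)) ⟩
  + 5 ℤ.* f n ℤ.- tmSum (5 * n) ℤ.+ sumBelow (λ j → window n (5 * j div 16) ℤ.* sgn (5 * j % 16)) 16
    ≡⟨ cong (λ x → + 5 ℤ.* f n ℤ.- tmSum (5 * n) ℤ.+ x) (block-identity (window n)) ⟩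
  + 5 ℤ.* f n ℤ.- tmSum (5 * n) ℤ.+ (+ 5 ℤ.* window n 0 ℤ.- sumBelow (window n) 5)
    ≡⟨ ring (f n) (tmSum (5 * n)) (window n 0) (sumBelow (window n) 5) ⟩
  + 5 ℤ.* (f n ℤ.+ window n 0) ℤ.- (tmSum (5 * n) ℤ.+ sumBelow (window n) 5)
    ≡⟨ cong₂ (λ x y → + 5 ℤ.* (f n ℤ.+ sgn x) ℤ.- y) (+-identityʳ (5 * n)) (sym (sumBelow-+ sgn (5 * n) 5)) ⟩
  + 5 ℤ.* f (suc n) ℤ.- tmSum (5 * n + 5)
    ≡⟨ cong (λ x → + 5 ℤ.* f (suc n) ℤ.- tmSum x) (trans (+-comm (5 * n) 5) (sym (*-suc 5 n))) ⟩
  + 5 ℤ.* f (suc n) ℤ.- tmSum (5 * suc n)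
    ∎
  where
  open ≡-Reasoning
  ring : ∀ F T a S → + 5 ℤ.* F ℤ.- T ℤ.+ (+ 5 ℤ.* a ℤ.- S) ≡ + 5 ℤ.* (F ℤ.+ a) ℤ.- (T ℤ.+ S)
  ring = ℤ-Solver.solve-∀

tmSum-step : ∀ n r → tmSum (5 * (r + n * 16)) ≡ nextTmSum (window n) r
tmSum-step n r = begin
  tmSum (5 * (r + n * 16))     ≡⟨ cong tmSum (ring n r) ⟩
  tmSum (5 * n * 16 + 5 * r)   ≡⟨ sumBelow-+ sgn (5 * n * 16) (5 * r) ⟩
  tmSum (5 * n * 16) ℤ.+ sumBelow (λ i → sgn (5 * n * 16 + i)) (5 * r)
    ≡⟨ cong₂ ℤ._+_ (trans (cong tmSum (sym (*-assoc (5 * n) 8 2))) (tmSum-even (5 * n * 8)))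
                   (sumBelow-cong (5 * r) (λ {i} _ → sgn-split (5 * n) i)) ⟩
  0ℤ ℤ.+ nextTmSum (window n) r   ≡⟨ ℤₚ.+-identityˡ _ ⟩
  nextTmSum (window n) r          ∎
  where
  open ≡-Reasoning
  ring : ∀ n r → 5 * (r + n * 16) ≡ 5 * n * 16 + 5 * r
  ring = solve-∀

window-step : ∀ n r q → window (r + n * 16) q ≡ nextWindow (window n) r q
window-step n r q = trans (cong sgn (ring n r q)) (sgn-split (5 * n) (5 * r + q))
  where
  ring : ∀ n r q → 5 * (r + n * 16) + q ≡ 5 * n * 16 + (5 * r + q)
  ring = solve-∀

f-step : ∀ n r → f (r + n * 16) ≡ + 5 ℤ.* f n ℤ.+ increment (tmSum (5 * n)) (window n) r
f-step n r = begin
  f (r + n * 16)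
    ≡⟨ trans (cong f (+-comm r (n * 16))) (sumBelow-+ _ (n * 16) r) ⟩
  f (n * 16) ℤ.+ sumBelow (λ j → sgn (5 * (n * 16 + j))) r
    ≡⟨ cong₂ ℤ._+_ (f-16 n) (sumBelow-cong r (λ {j} _ → sgn-5*-split n j)) ⟩
  + 5 ℤ.* f n ℤ.- tmSum (5 * n) ℤ.+ sumBelow (λ j → window n (5 * j div 16) ℤ.* sgn (5 * j % 16)) r
    ≡⟨ ring (+ 5 ℤ.* f n) (tmSum (5 * n)) _ ⟩
  + 5 ℤ.* f n ℤ.+ increment (tmSum (5 * n)) (window n) r
    ∎
  where
  open ≡-Reasoning
  ring : ∀ F T S → F ℤ.- T ℤ.+ S ≡ F ℤ.+ (ℤ.- T ℤ.+ S)
  ring = ℤ-Solver.solve-∀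

-- The automaton

-- Row s of τ-table and ε-table lists tmSum (5 n) and sgn (5 n + q), q < 5, for every n in state s;
-- lower-table and upper-table hold the bounds of the two certificates below, by state and carry.
module Tables where
  open import Agda.Builtin.FromNat using (Number; fromNat)
  open import Agda.Builtin.FromNeg using (Negative; fromNeg)
  import Data.Fin.Literals as FinLit
  import Data.Integer.Literals as ℤLit
  import Data.Nat.Literals as ℕLit
  open import Data.Unit.Base using (tt)

  instance
    _ = tt
    _ = ℕLit.number
    _ = ℤLit.number
    _ = ℤLit.negative
    _ : ∀ {n} → Number (Fin n)
    _ = FinLit.number _

  initial : Fin 12
  initial = 6

  τ-table : Vec ℤ 12
  τ-table = -1 ∷ -1 ∷ -1 ∷ 0 ∷ 0 ∷ 0 ∷ 0 ∷ 0 ∷ 0 ∷ 1 ∷ 1 ∷ 1 ∷ []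

  ε-table : Vec (Vec ℤ 5) 12
  ε-table =
    (1 ∷ -1 ∷ 1 ∷ 1 ∷ -1 ∷ []) ∷
    (1 ∷ 1 ∷ -1 ∷ -1 ∷ 1 ∷ []) ∷
    (1 ∷ 1 ∷ -1 ∷ 1 ∷ -1 ∷ []) ∷
    (-1 ∷ 1 ∷ -1 ∷ 1 ∷ 1 ∷ []) ∷
    (-1 ∷ 1 ∷ 1 ∷ -1 ∷ -1 ∷ []) ∷
    (-1 ∷ 1 ∷ 1 ∷ -1 ∷ 1 ∷ []) ∷
    (1 ∷ -1 ∷ -1 ∷ 1 ∷ -1 ∷ []) ∷
    (1 ∷ -1 ∷ -1 ∷ 1 ∷ 1 ∷ []) ∷
    (1 ∷ -1 ∷ 1 ∷ -1 ∷ -1 ∷ []) ∷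
    (-1 ∷ -1 ∷ 1 ∷ -1 ∷ 1 ∷ []) ∷
    (-1 ∷ -1 ∷ 1 ∷ 1 ∷ -1 ∷ []) ∷
    (-1 ∷ 1 ∷ -1 ∷ -1 ∷ 1 ∷ []) ∷
    []

  δ-table : Vec (Vec (Fin 12) 16) 12
  δ-table =
    (6 ∷ 1 ∷ 8 ∷ 0 ∷ 7 ∷ 9 ∷ 8 ∷ 0 ∷ 5 ∷ 10 ∷ 3 ∷ 10 ∷ 6 ∷ 2 ∷ 4 ∷ 0 ∷ []) ∷
    (6 ∷ 1 ∷ 8 ∷ 1 ∷ 4 ∷ 2 ∷ 3 ∷ 11 ∷ 6 ∷ 1 ∷ 8 ∷ 1 ∷ 5 ∷ 9 ∷ 7 ∷ 11 ∷ []) ∷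
    (6 ∷ 1 ∷ 8 ∷ 1 ∷ 4 ∷ 2 ∷ 3 ∷ 11 ∷ 6 ∷ 2 ∷ 3 ∷ 10 ∷ 6 ∷ 2 ∷ 4 ∷ 0 ∷ []) ∷
    (5 ∷ 10 ∷ 3 ∷ 11 ∷ 4 ∷ 2 ∷ 3 ∷ 11 ∷ 6 ∷ 2 ∷ 3 ∷ 10 ∷ 7 ∷ 9 ∷ 7 ∷ 11 ∷ []) ∷
    (5 ∷ 10 ∷ 3 ∷ 11 ∷ 4 ∷ 2 ∷ 4 ∷ 0 ∷ 5 ∷ 9 ∷ 8 ∷ 1 ∷ 4 ∷ 2 ∷ 4 ∷ 0 ∷ []) ∷
    (5 ∷ 10 ∷ 3 ∷ 11 ∷ 4 ∷ 2 ∷ 4 ∷ 0 ∷ 5 ∷ 9 ∷ 8 ∷ 1 ∷ 5 ∷ 9 ∷ 7 ∷ 11 ∷ []) ∷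
    (6 ∷ 1 ∷ 8 ∷ 0 ∷ 7 ∷ 9 ∷ 7 ∷ 11 ∷ 6 ∷ 2 ∷ 3 ∷ 10 ∷ 6 ∷ 2 ∷ 4 ∷ 0 ∷ []) ∷
    (6 ∷ 1 ∷ 8 ∷ 0 ∷ 7 ∷ 9 ∷ 7 ∷ 11 ∷ 6 ∷ 2 ∷ 3 ∷ 10 ∷ 7 ∷ 9 ∷ 7 ∷ 11 ∷ []) ∷
    (6 ∷ 1 ∷ 8 ∷ 0 ∷ 7 ∷ 9 ∷ 8 ∷ 0 ∷ 5 ∷ 9 ∷ 8 ∷ 1 ∷ 4 ∷ 2 ∷ 4 ∷ 0 ∷ []) ∷
    (5 ∷ 10 ∷ 3 ∷ 10 ∷ 7 ∷ 9 ∷ 8 ∷ 0 ∷ 5 ∷ 9 ∷ 8 ∷ 1 ∷ 5 ∷ 9 ∷ 7 ∷ 11 ∷ []) ∷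
    (5 ∷ 10 ∷ 3 ∷ 10 ∷ 7 ∷ 9 ∷ 8 ∷ 0 ∷ 5 ∷ 10 ∷ 3 ∷ 10 ∷ 6 ∷ 2 ∷ 4 ∷ 0 ∷ []) ∷
    (5 ∷ 10 ∷ 3 ∷ 11 ∷ 4 ∷ 2 ∷ 3 ∷ 11 ∷ 6 ∷ 1 ∷ 8 ∷ 1 ∷ 5 ∷ 9 ∷ 7 ∷ 11 ∷ []) ∷
    []

  lower-table : Vec (Vec ℤ 4) 12
  lower-table =
    (-177 ∷ -1 ∷ 175 ∷ 563 ∷ []) ∷
    (81 ∷ -47 ∷ 129 ∷ 305 ∷ []) ∷
    (-83 ∷ 93 ∷ 269 ∷ 2381 ∷ []) ∷
    (234 ∷ 410 ∷ 2522 ∷ 2698 ∷ []) ∷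
    (46 ∷ 222 ∷ 2334 ∷ 2510 ∷ []) ∷
    (1064 ∷ 2792 ∷ 2968 ∷ 3144 ∷ []) ∷
    (-212 ∷ -36 ∷ 140 ∷ 316 ∷ []) ∷
    (70 ∷ 246 ∷ 422 ∷ 2534 ∷ []) ∷
    (-94 ∷ 82 ∷ 258 ∷ 434 ∷ []) ∷
    (293 ∷ 469 ∷ 2581 ∷ 2757 ∷ []) ∷
    (11 ∷ 187 ∷ 363 ∷ 2475 ∷ []) ∷
    (199 ∷ 375 ∷ 2439 ∷ 2663 ∷ []) ∷
    []

  upper-table : Vec (Vec ℤ 4) 12
  upper-table =
    (41 ∷ 37 ∷ 33 ∷ 29 ∷ []) ∷
    (191 ∷ 15 ∷ 11 ∷ 7 ∷ []) ∷
    (123 ∷ 119 ∷ 71 ∷ 67 ∷ []) ∷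
    (134 ∷ 86 ∷ 82 ∷ 78 ∷ []) ∷
    (194 ∷ 146 ∷ 142 ∷ 138 ∷ []) ∷
    (292 ∷ 288 ∷ 284 ∷ 176 ∷ []) ∷
    (112 ∷ 108 ∷ 104 ∷ 56 ∷ []) ∷
    (52 ∷ 48 ∷ 44 ∷ -4 ∷ []) ∷
    (30 ∷ 26 ∷ 22 ∷ 18 ∷ []) ∷
    (63 ∷ 59 ∷ 11 ∷ 7 ∷ []) ∷
    (153 ∷ 149 ∷ 101 ∷ 97 ∷ []) ∷
    (93 ∷ 89 ∷ 41 ∷ 37 ∷ []) ∷
    []

State : Set
State = Fin 12

τ : State → ℤ
τ = lookup Tables.τ-table

ε : State → ℕ → ℤ
ε s q = lookup (lookup Tables.ε-table s) (q mod 5)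

δ : State → ℕ → State
δ s r = lookup (lookup Tables.δ-table s) (r mod 16)

TransitionValid : State → ℕ → Set
TransitionValid s r = τ (δ s r) ≡ nextTmSum (ε s) r × (∀ {q} → q < 5 → ε (δ s r) q ≡ nextWindow (ε s) r q)

transitions-valid : ∀ s {r} → r < 16 → TransitionValid s r
transitions-valid = from-yes (Fin.all? λ s → allUpTo? (λ r → τ (δ s r) ℤ.≟ nextTmSum (ε s) r
  ×-dec allUpTo? (λ q → ε (δ s r) q ℤ.≟ nextWindow (ε s) r q) 5) 16)

record Describes (s : State) (n : ℕ) : Set where
  constructor describes
  field
    tmSum≡τ     : tmSum (5 * n) ≡ τ s
    window≡ε : ∀ {q} → q < 5 → window n q ≡ ε s q

below5 : ∀ {r i} → r ≤ 16 → i < 5 * r → i div 16 < 5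
below5 {r} r≤16 i<5r = m<n*o⇒m/o<n (<-≤-trans i<5r (*-monoʳ-≤ 5 r≤16))

describes-step : ∀ {s n r} → Describes s n → r < 16 → Describes (δ s r) (r + n * 16)
describes-step {s} {n} {r} (describes tmSum≡τ window≡ε) r<16 = describes tmSum≡τ′ window≡ε′
  where
  open ≡-Reasoning
  valid = transitions-valid s r<16
  tmSum≡τ′ : tmSum (5 * (r + n * 16)) ≡ τ (δ s r)
  tmSum≡τ′ = begin
    tmSum (5 * (r + n * 16))   ≡⟨ tmSum-step n r ⟩
    nextTmSum (window n) r
      ≡⟨ sumBelow-cong (5 * r) (λ i<5r → cong (ℤ._* _) (window≡ε (below5 (<⇒≤ r<16) i<5r))) ⟩
    nextTmSum (ε s) r          ≡⟨ sym (proj₁ valid) ⟩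
    τ (δ s r)               ∎
  window≡ε′ : ∀ {q} → q < 5 → window (r + n * 16) q ≡ ε (δ s r) q
  window≡ε′ {q} q<5 = begin
    window (r + n * 16) q       ≡⟨ window-step n r q ⟩
    nextWindow (window n) r q   ≡⟨ cong (ℤ._* _) (window≡ε (below5 {suc r} r<16 5r+q<5[r+1])) ⟩
    nextWindow (ε s) r q        ≡⟨ sym (proj₂ valid q<5) ⟩
    ε (δ s r) q                 ∎
    where
    5r+q<5[r+1] : 5 * r + q < 5 * suc r
    5r+q<5[r+1] = <-≤-trans (+-monoʳ-< (5 * r) q<5) (≤-reflexive (trans (+-comm (5 * r) 5) (sym (*-suc 5 r))))

open Tables using (initial)

state : ℕ → State
state n = foldl δ initial (digits 16 n)

1<16 : 1 < 16
1<16 = s≤s (s≤s z≤n)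

state-step : ∀ n {r} → r < 16 → state (r + n * 16) ≡ δ (state n) r
state-step zero    {zero}  _    = refl
state-step zero    {suc r} r<16 = cong (foldl δ initial) (digits-snoc 16 1<16 0 (suc r) r<16 z<s)
state-step (suc n) {r}     r<16 = trans (cong (foldl δ initial) (digits-snoc 16 1<16 (suc n) r r<16 0<n))
                                        (foldl-++ δ initial (digits 16 (suc n)) [ r ])
  where
  0<n : 0 < r + suc n * 16
  0<n = ≤-trans (s≤s z≤n) (m≤n+m (suc n * 16) r)

initial-describes : Describes initial 0
initial-describes = describes refl (from-yes (allUpTo? (λ q → window 0 q ℤ.≟ ε initial q) 5))

state-describes : ∀ n → Describes (state n) n
state-describes = digit-induction 16 1<16 (λ n → Describes (state n) n) initial-describes
  λ {r} {n} r<16 d → subst (λ s → Describes s (r + n * 16)) (sym (state-step n r<16)) (describes-step d r<16)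

D : State → ℕ → ℤ
D s r = increment (τ s) (ε s) r

increment-cong : ∀ {T T′ w w′ r} → T ≡ T′ → (∀ {q} → q < 5 → w q ≡ w′ q) → r ≤ 16 →
                 increment T w r ≡ increment T′ w′ r
increment-cong {r = r} T≡T′ w≡w′ r≤16 = cong₂ (λ T S → ℤ.- T ℤ.+ S) T≡T′
  (sumBelow-cong r λ j<r → cong (ℤ._* _) (w≡w′ (below5 r≤16 (*-monoʳ-< 5 j<r))))

f-digit : ∀ n {r} → r < 16 → f (r + n * 16) ≡ + 5 ℤ.* f n ℤ.+ D (state n) r
f-digit n {r} r<16 = begin
  f (r + n * 16)                                          ≡⟨ f-step n r ⟩
  + 5 ℤ.* f n ℤ.+ increment (tmSum (5 * n)) (window n) r
    ≡⟨ cong (λ x → + 5 ℤ.* f n ℤ.+ x) (increment-cong tmSum≡τ window≡ε (<⇒≤ r<16)) ⟩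
  + 5 ℤ.* f n ℤ.+ D (state n) r
    ∎
  where
  open ≡-Reasoning
  open Describes (state-describes n)

D-bounded : ∀ s {r} → r < 16 → ℤ.- + 7 ℤ.≤ D s r × D s r ℤ.≤ + 7
D-bounded = from-yes (Fin.all? λ s → allUpTo? (λ r → ℤ.- + 7 ℤ.≤? D s r ×-dec D s r ℤ.≤? + 7) 16)

-- Carries

Carry : Set
Carry = Fin 4

offset : Carry → ℤ
offset k = + toℕ k ℤ.- + 2

carry : State → ℕ → Carry → Carry
carry s r k = ∣ (D s r ℤ.+ offset k) /ℕ 5 ℤ.+ + 2 ∣ mod 4

digit : State → ℕ → Carry → ℕ
digit s r k = (D s r ℤ.+ offset k) %ℕ 5

-- carry s r k is meant to be ⌊(D s r + offset k) / 5⌋, which must lie in [-2, 1]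
carries-in-range : ∀ s {r} → r < 16 → ∀ k → offset (carry s r k) ≡ (D s r ℤ.+ offset k) /ℕ 5
carries-in-range = from-yes (Fin.all? λ s → allUpTo? (λ r → Fin.all? λ k →
  offset (carry s r k) ℤ.≟ (D s r ℤ.+ offset k) /ℕ 5) 16)

carry-equation : ∀ s {r} → r < 16 → ∀ k → D s r ℤ.+ offset k ≡ + 5 ℤ.* offset (carry s r k) ℤ.+ + digit s r k
carry-equation s {r} r<16 k = begin
  D s r ℤ.+ offset k
    ≡⟨ a≡a%ℕn+[a/ℕn]*n _ 5 ⟩
  + digit s r k ℤ.+ (D s r ℤ.+ offset k) /ℕ 5 ℤ.* + 5
    ≡⟨ cong (λ q → + digit s r k ℤ.+ q ℤ.* + 5) (carries-in-range s r<16 k) ⟨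
  + digit s r k ℤ.+ offset (carry s r k) ℤ.* + 5
    ≡⟨ ring (+ digit s r k) (offset (carry s r k)) ⟩
  + 5 ℤ.* offset (carry s r k) ℤ.+ + digit s r k
    ∎
  where
  open ≡-Reasoning
  ring : ∀ d q → d ℤ.+ q ℤ.* + 5 ≡ + 5 ℤ.* q ℤ.+ d
  ring = ℤ-Solver.solve-∀

nonNeg-expansion : ∀ c w d → d < c → 0ℤ ℤ.≤ + c ℤ.* w ℤ.+ + d →
                   0ℤ ℤ.≤ w × ∣ + c ℤ.* w ℤ.+ + d ∣ ≡ d + ∣ w ∣ * c
nonNeg-expansion c (+ a) d _ _ = ℤ.+≤+ z≤n , (begin
  ∣ + c ℤ.* + a ℤ.+ + d ∣     ≡⟨ cong (λ x → ∣ x ℤ.+ + d ∣) (sym (ℤₚ.pos-* c a)) ⟩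
  ∣ + (c * a) ℤ.+ + d ∣       ≡⟨ cong ∣_∣ (sym (ℤₚ.pos-+ (c * a) d)) ⟩
  c * a + d                   ≡⟨ +-comm (c * a) d ⟩
  d + c * a                   ≡⟨ cong (λ x → d + x) (*-comm c a) ⟩
  d + a * c                   ∎)
  where open ≡-Reasoning
nonNeg-expansion c -[1+ a ] d d<c 0≤ =
  ⊥-elim (<⇒≱ d<c (ℤₚ.drop‿+≤+ (ℤₚ.0≤i-j⇒j≤i (ℤₚ.≤-trans 0≤ bound))))
  where
  bound : + c ℤ.* -[1+ a ] ℤ.+ + d ℤ.≤ + d ℤ.- + c
  bound = ℤₚ.≤-trans (ℤₚ.+-monoˡ-≤ (+ d) (ℤₚ.*-monoˡ-≤-nonNeg (+ c) (ℤ.-≤- z≤n)))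
                     (ℤₚ.≤-reflexive (ring (+ c) (+ d)))
    where
    ring : ∀ c d → c ℤ.* -1ℤ ℤ.+ d ≡ d ℤ.- c
    ring = ℤ-Solver.solve-∀

Y : Carry → ℕ → ℕ
Y k n = p516 ∣ f n ℤ.+ offset k ∣

Y-step : ∀ n {r} → r < 16 → ∀ k → 0ℤ ℤ.≤ f (r + n * 16) ℤ.+ offset k →
         0ℤ ℤ.≤ f n ℤ.+ offset (carry (state n) r k)
         × Y k (r + n * 16) ≡ digit (state n) r k + Y (carry (state n) r k) n * 16
Y-step n {r} r<16 k 0≤ = proj₁ expansion , (begin
  p516 ∣ f (r + n * 16) ℤ.+ offset k ∣     ≡⟨ cong (λ x → p516 ∣ x ∣) value ⟩
  p516 ∣ + 5 ℤ.* w ℤ.+ + d ∣              ≡⟨ cong p516 (proj₂ expansion) ⟩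
  p516 (d + ∣ w ∣ * 5)                    ≡⟨ evalDigits-digits-snoc 5 (s≤s (s≤s z≤n)) 16 ∣ w ∣ d d<5 ⟩
  d + Y k′ n * 16                         ∎)
  where
  open ≡-Reasoning
  s = state n
  k′ = carry s r k
  d = digit s r k
  w = f n ℤ.+ offset k′
  d<5 : d < 5
  d<5 = n%ℕd<d (D s r ℤ.+ offset k) 5
  value : f (r + n * 16) ℤ.+ offset k ≡ + 5 ℤ.* w ℤ.+ + d
  value = begin
    f (r + n * 16) ℤ.+ offset k                    ≡⟨ cong (ℤ._+ offset k) (f-digit n r<16) ⟩
    + 5 ℤ.* f n ℤ.+ D s r ℤ.+ offset k             ≡⟨ ℤₚ.+-assoc (+ 5 ℤ.* f n) (D s r) (offset k) ⟩
    + 5 ℤ.* f n ℤ.+ (D s r ℤ.+ offset k)           ≡⟨ cong (λ x → + 5 ℤ.* f n ℤ.+ x) (carry-equation s r<16 k) ⟩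
    + 5 ℤ.* f n ℤ.+ (+ 5 ℤ.* offset k′ ℤ.+ + d)    ≡⟨ ring (f n) (offset k′) (+ d) ⟩
    + 5 ℤ.* w ℤ.+ + d                              ∎
    where
    ring : ∀ F K d → + 5 ℤ.* F ℤ.+ (+ 5 ℤ.* K ℤ.+ d) ≡ + 5 ℤ.* (F ℤ.+ K) ℤ.+ d
    ring = ℤ-Solver.solve-∀
  expansion = nonNeg-expansion 5 w d d<5 (subst (0ℤ ℤ.≤_) value 0≤)

-- Linear forms along the automaton

form : ℤ → ℤ → ℕ → ℕ → ℤ
form α β n y = α ℤ.* + y ℤ.- β ℤ.* + n

form-step : ∀ α β r n d y → form α β (r + n * 16) (d + y * 16) ≡ + 16 ℤ.* form α β n y ℤ.+ form α β r d
form-step α β r n d y = begin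
  α ℤ.* + (d + y * 16) ℤ.- β ℤ.* + (r + n * 16)
    ≡⟨ cong₂ (λ u v → α ℤ.* u ℤ.- β ℤ.* v) (pos-expansion d y) (pos-expansion r n) ⟩
  α ℤ.* (+ d ℤ.+ + y ℤ.* + 16) ℤ.- β ℤ.* (+ r ℤ.+ + n ℤ.* + 16)
    ≡⟨ ring α β (+ r) (+ n) (+ d) (+ y) ⟩
  + 16 ℤ.* form α β n y ℤ.+ form α β r d
    ∎
  where
  open ≡-Reasoning
  pos-expansion : ∀ a b → + (a + b * 16) ≡ + a ℤ.+ + b ℤ.* + 16
  pos-expansion a b = trans (ℤₚ.pos-+ a (b * 16)) (cong (λ x → + a ℤ.+ x) (ℤₚ.pos-* b 16))
  ring : ∀ α β r n d y → α ℤ.* (d ℤ.+ y ℤ.* + 16) ℤ.- β ℤ.* (r ℤ.+ n ℤ.* + 16)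
                         ≡ + 16 ℤ.* (α ℤ.* y ℤ.- β ℤ.* n) ℤ.+ (α ℤ.* d ℤ.- β ℤ.* r)
  ring = ℤ-Solver.solve-∀

lift-≤ : ∀ {B′ X′} m c → B′ ℤ.≤ X′ → + m ℤ.* B′ ℤ.+ c ℤ.≤ + m ℤ.* X′ ℤ.+ c
lift-≤ m c B′≤X′ = ℤₚ.+-monoˡ-≤ c (ℤₚ.*-monoˡ-≤-nonNeg (+ m) B′≤X′)

squeeze : ∀ {B B′ X′} m .{{_ : NonZero m}} c → B′ ℤ.≤ X′ → B ℤ.≤ + m ℤ.* B′ ℤ.+ c →
          + m ℤ.* X′ ℤ.+ c ≡ B → + m ℤ.* B′ ℤ.+ c ≡ B × X′ ≡ B′
squeeze {B} {B′} {X′} m c B′≤X′ B≤ X≡B =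
  lifted≡B , ℤₚ.*-cancelˡ-≡ (+ m) X′ B′ (∙-cancelʳ c _ _ (trans X≡B (sym lifted≡B)))
  where
  lifted≡B : + m ℤ.* B′ ℤ.+ c ≡ B
  lifted≡B = ℤₚ.≤-antisym (subst (_ ℤ.≤_) X≡B (lift-≤ m c B′≤X′)) B≤

replicate-∷ʳ : ∀ {A : Set} j (x : A) → replicate j x ++ [ x ] ≡ replicate (suc j) x
replicate-∷ʳ zero    x = refl
replicate-∷ʳ (suc j) x = cong (x ∷_) (replicate-∷ʳ j x)

noCarry : Carry
noCarry = # 2

-- bound s k ≤ α (Y k n) − β n for all n ≥ 1 in state s with f n + offset k ≥ 0; where tight s k
-- holds, equality forces the digits of n to be loopDigit⁺.  The aim is least ≤ α (Y noCarry n) − β n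
-- for n ≥ 2, with equality exactly for the digits loopDigit* lastDigit.
record Certificate : Set where
  field
    α β        : ℤ
    bound      : State → Carry → ℤ
    tight      : State → Carry → Bool
    loopDigit  : ℕ
    lastDigit  : ℕ
    least      : ℤ
    loopState  : State
    loopCarry  : Carry

module Bounds (C : Certificate) where
  open Certificate C

  value : Carry → ℕ → ℤ
  value k n = form α β n (Y k n)

  propagated : State → ℕ → Carry → ℤ
  propagated s r k = + 16 ℤ.* bound s (carry s r k) ℤ.+ form α β r (digit s r k)

  Repdigit : ℕ → Set
  Repdigit n = ∃ λ j → digits 16 n ≡ replicate (suc j) loopDigit

  Extremal : ℕ → Set
  Extremal n = ∃ λ j → digits 16 n ≡ replicate j loopDigit ++ [ lastDigit ]

  EdgeValid : State → ℕ → Carry → Set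
  EdgeValid s r k =
    bound (δ s r) k ℤ.≤ propagated s r k
    × (T (tight (δ s r) k) → propagated s r k ≡ bound (δ s r) k → T (tight s (carry s r k)) × r ≡ loopDigit)

  LastEdgeValid : State → ℕ → Set
  LastEdgeValid s r = least ℤ.≤ propagated s r noCarry
                    × (propagated s r noCarry ≡ least → T (tight s (carry s r noCarry)) × r ≡ lastDigit)

  InitialValid : ℕ → Carry → Set
  InitialValid n k = 0ℤ ℤ.≤ f n ℤ.+ offset k → bound (state n) k ℤ.≤ value k n
                   × (T (tight (state n) k) → value k n ≡ bound (state n) k → n ≡ loopDigit)

  InitialLastValid : ℕ → Set
  InitialLastValid n = 0ℤ ℤ.≤ f n ℤ.+ offset noCarry → least ℤ.≤ value noCarry n
                     × (value noCarry n ≡ least → n ≡ lastDigit) × (n ≡ lastDigit → value noCarry n ≡ least)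

  record LoopValid : Set where
    field
      state-loop     : state loopDigit ≡ loopState
      value-loop     : value loopCarry loopDigit ≡ bound loopState loopCarry
      δ-loop         : δ loopState loopDigit ≡ loopState
      carry-loop     : carry loopState loopDigit loopCarry ≡ loopCarry
      propagate-loop : propagated loopState loopDigit loopCarry ≡ bound loopState loopCarry
      carry-last     : carry loopState lastDigit noCarry ≡ loopCarry
      propagate-last : propagated loopState lastDigit noCarry ≡ least

  record Valid : Set where
    field
      edges        : ∀ s {r} → r < 16 → ∀ k → EdgeValid s r k
      lastEdges    : ∀ s {r} → r < 16 → LastEdgeValid s r
      initials     : ∀ {n} → n < 16 → 1 ≤ n → ∀ k → InitialValid n k
      initialLasts : ∀ {n} → n < 16 → 2 ≤ n → InitialLastValid n
      loop         : LoopValid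

  edges? : Dec (∀ s {r} → r < 16 → ∀ k → EdgeValid s r k)
  edges? = Fin.all? λ s → allUpTo? (λ r → Fin.all? λ k →
    bound (δ s r) k ℤ.≤? propagated s r k
    ×-dec (T? (tight (δ s r) k) →-dec propagated s r k ℤ.≟ bound (δ s r) k →-dec
             T? (tight s (carry s r k)) ×-dec r ≟ loopDigit)) 16

  lastEdges? : Dec (∀ s {r} → r < 16 → LastEdgeValid s r)
  lastEdges? = Fin.all? λ s → allUpTo? (λ r →
    least ℤ.≤? propagated s r noCarry
    ×-dec (propagated s r noCarry ℤ.≟ least →-dec T? (tight s (carry s r noCarry)) ×-dec r ≟ lastDigit)) 16

  initials? : Dec (∀ {n} → n < 16 → 1 ≤ n → ∀ k → InitialValid n k)
  initials? = allUpTo? (λ n → 1 ≤? n →-dec Fin.all? λ k →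
    0ℤ ℤ.≤? f n ℤ.+ offset k →-dec
      bound (state n) k ℤ.≤? value k n
      ×-dec (T? (tight (state n) k) →-dec value k n ℤ.≟ bound (state n) k →-dec n ≟ loopDigit)) 16

  initialLasts? : Dec (∀ {n} → n < 16 → 2 ≤ n → InitialLastValid n)
  initialLasts? = allUpTo? (λ n → 2 ≤? n →-dec
    0ℤ ℤ.≤? f n ℤ.+ offset noCarry →-dec
      least ℤ.≤? value noCarry n
      ×-dec (value noCarry n ℤ.≟ least →-dec n ≟ lastDigit)
      ×-dec (n ≟ lastDigit →-dec value noCarry n ℤ.≟ least)) 16

  value-step : ∀ n {r} → r < 16 → ∀ k → 0ℤ ℤ.≤ f (r + n * 16) ℤ.+ offset k →
               0ℤ ℤ.≤ f n ℤ.+ offset (carry (state n) r k)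
               × value k (r + n * 16) ≡ + 16 ℤ.* value (carry (state n) r k) n ℤ.+ form α β r (digit (state n) r k)
  value-step n {r} r<16 k 0≤ =
    proj₁ step , trans (cong (form α β (r + n * 16)) (proj₂ step)) (form-step α β r n _ _)
    where step = Y-step n r<16 k 0≤

  repdigit-snoc : ∀ {n r} → r < 16 → r ≡ loopDigit → Repdigit n → Repdigit (r + n * 16)
  repdigit-snoc {zero}  _    _    (_ , ())
  repdigit-snoc {suc n} r<16 refl (j , digits≡) = suc j , (begin
    digits 16 (loopDigit + suc n * 16)                   ≡⟨ digits-snoc 16 1<16 (suc n) loopDigit r<16 0<n ⟩
    digits 16 (suc n) ++ [ loopDigit ]                   ≡⟨ cong (_++ [ loopDigit ]) digits≡ ⟩
    replicate (suc j) loopDigit ++ [ loopDigit ]         ≡⟨ replicate-∷ʳ (suc j) loopDigit ⟩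
    replicate (suc (suc j)) loopDigit                    ∎)
    where
    open ≡-Reasoning
    0<n : 0 < loopDigit + suc n * 16
    0<n = ≤-trans (s≤s z≤n) (m≤n+m (suc n * 16) loopDigit)

  module Theory (valid : Valid) where
    open Valid valid
    open LoopValid loop

    Invariant : ℕ → Set
    Invariant n = ∀ k → 0ℤ ℤ.≤ f n ℤ.+ offset k → bound (state n) k ℤ.≤ value k n
                      × (T (tight (state n) k) → value k n ≡ bound (state n) k → Repdigit n)

    invariant-step : ∀ n {r} → r < 16 → Invariant n → Invariant (r + n * 16)
    invariant-step n {r} r<16 inv k 0≤ rewrite state-step n r<16 = lower , tightness
      where
      s = state n
      k′ = carry s r k
      c = form α β r (digit s r k)
      step = value-step n r<16 k 0≤
      edge = edges s r<16 k
      inv′ = inv k′ (proj₁ step)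
      lower : bound (δ s r) k ℤ.≤ value k (r + n * 16)
      lower = ℤₚ.≤-trans (proj₁ edge)
        (subst (propagated s r k ℤ.≤_) (sym (proj₂ step)) (lift-≤ 16 c (proj₁ inv′)))
      tightness : T (tight (δ s r) k) → value k (r + n * 16) ≡ bound (δ s r) k → Repdigit (r + n * 16)
      tightness tight-k value≡ =
        let attained = squeeze 16 c (proj₁ inv′) (proj₁ edge) (trans (sym (proj₂ step)) value≡)
            previous = proj₂ edge tight-k (proj₁ attained)
        in repdigit-snoc {n} r<16 (proj₂ previous) (proj₂ inv′ (proj₁ previous) (proj₂ attained))

    invariant : ∀ n → 1 ≤ n → Invariant n
    invariant = digit-induction 16 1<16 (λ n → 1 ≤ n → Invariant n) (λ ()) step
      where
      initial-invariant : ∀ {n} → n < 16 → 1 ≤ n → Invariant n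
      initial-invariant n<16 1≤n k 0≤ =
        let initial = initials n<16 1≤n k 0≤
        in proj₁ initial , λ tight-k value≡ →
             0 , trans (digits-digit 16 1<16 1≤n n<16) (cong [_] (proj₂ initial tight-k value≡))
      step : ∀ {r n} → r < 16 → (1 ≤ n → Invariant n) → 1 ≤ r + n * 16 → Invariant (r + n * 16)
      step {r} {zero}  r<16 _  1≤r = subst Invariant (sym (+-identityʳ r))
                                       (initial-invariant r<16 (subst (1 ≤_) (+-identityʳ r) 1≤r))
      step {r} {suc n} r<16 ih _   = invariant-step (suc n) r<16 (ih (s≤s z≤n))

    LoopValue : ℕ → Set
    LoopValue n = state n ≡ loopState
                × (0ℤ ℤ.≤ f n ℤ.+ offset loopCarry → value loopCarry n ≡ bound loopState loopCarry)

    value-after-loop : ∀ n {r} → r < 16 → ∀ k → LoopValue n → carry loopState r k ≡ loopCarry →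
                       0ℤ ℤ.≤ f (r + n * 16) ℤ.+ offset k → value k (r + n * 16) ≡ propagated loopState r k
    value-after-loop n {r} r<16 k (state≡ , value≡) carry≡ 0≤ = begin
      value k (r + n * 16)                                                            ≡⟨ proj₂ step ⟩
      + 16 ℤ.* value (carry (state n) r k) n ℤ.+ form α β r (digit (state n) r k)
        ≡⟨ cong (λ s → + 16 ℤ.* value (carry s r k) n ℤ.+ form α β r (digit s r k)) state≡ ⟩
      + 16 ℤ.* value (carry loopState r k) n ℤ.+ form α β r (digit loopState r k)
        ≡⟨ cong (λ v → + 16 ℤ.* v ℤ.+ form α β r (digit loopState r k)) value≡bound ⟩
      propagated loopState r k                                                        ∎
      where
      open ≡-Reasoning
      step = value-step n r<16 k 0≤
      carry≡′ : carry (state n) r k ≡ loopCarry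
      carry≡′ = trans (cong (λ s → carry s r k) state≡) carry≡
      value≡bound : value (carry loopState r k) n ≡ bound loopState (carry loopState r k)
      value≡bound = subst (λ k′ → value k′ n ≡ bound loopState k′) (sym carry≡)
        (value≡ (subst (λ k′ → 0ℤ ℤ.≤ f n ℤ.+ offset k′) carry≡′ (proj₁ step)))

    repdigit-value      : ∀ j n → digits 16 n ≡ replicate (suc j) loopDigit → LoopValue n
    repdigit-snoc-value : ∀ j n → loopDigit < 16 → digits 16 n ≡ replicate j loopDigit → LoopValue (loopDigit + n * 16)

    repdigit-value j n digits≡
      with digits-unsnoc 16 1<16 n (replicate j loopDigit) loopDigit (trans digits≡ (sym (replicate-∷ʳ j loopDigit)))
    ... | digits≡′ , n%16≡ = subst LoopValue (sym n≡) (repdigit-snoc-value j (n div 16) loop<16 digits≡′)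
      where
      n≡ : n ≡ loopDigit + n div 16 * 16
      n≡ = trans (m≡m%n+[m/n]*n n 16) (cong (_+ n div 16 * 16) n%16≡)
      loop<16 : loopDigit < 16
      loop<16 = subst (_< 16) n%16≡ (m%n<n n 16)

    repdigit-snoc-value zero    n _       digits≡ rewrite digits≡[]⇒≡0 16 1<16 n digits≡ | +-identityʳ loopDigit =
      state-loop , λ _ → value-loop
    repdigit-snoc-value (suc j) n loop<16 digits≡ =
      trans (state-step n loop<16) (trans (cong (λ s → δ s loopDigit) (proj₁ previous)) δ-loop) ,
      λ 0≤ → trans (value-after-loop n loop<16 loopCarry previous carry-loop 0≤) propagate-loop
      where
      previous = repdigit-value j n digits≡

    LeastBound : ℕ → Set
    LeastBound n = 0ℤ ℤ.≤ f n ℤ.+ offset noCarry →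
                   least ℤ.≤ value noCarry n × (value noCarry n ≡ least ⇔ Extremal n)

    extremal-digit : ∀ {n} → 0 < n → n < 16 → Extremal n ⇔ n ≡ lastDigit
    extremal-digit {n} 0<n n<16 = mk⇔ to from
      where
      digits≡ = digits-digit 16 1<16 0<n n<16
      to : Extremal n → n ≡ lastDigit
      to (j , e) = proj₂ (∷ʳ-injective [] (replicate j loopDigit) (trans (sym digits≡) e))
      from : n ≡ lastDigit → Extremal n
      from refl = 0 , digits≡

    least-bound-snoc : ∀ n {r} → r < 16 → 2 ≤ r + n * 16 → LeastBound (r + n * 16)
    least-bound-snoc zero {r} r<16 2≤r =
      subst LeastBound (sym (+-identityʳ r)) (initial-least-bound r<16 (subst (2 ≤_) (+-identityʳ r) 2≤r))
      where
      initial-least-bound : ∀ {n} → n < 16 → 2 ≤ n → LeastBound n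
      initial-least-bound n<16 2≤n 0≤ =
        let initial = initialLasts n<16 2≤n 0≤
            extremal⇔ = extremal-digit (≤-trans (s≤s z≤n) 2≤n) n<16
        in proj₁ initial , mk⇔ (λ e → Equivalence.from extremal⇔ (proj₁ (proj₂ initial) e))
                               (λ x → proj₂ (proj₂ initial) (Equivalence.to extremal⇔ x))
    least-bound-snoc (suc n) {r} r<16 _ 0≤ = lower , mk⇔ attained⇒extremal extremal⇒attained
      where
      s = state (suc n)
      k′ = carry s r noCarry
      c = form α β r (digit s r noCarry)
      step = value-step (suc n) r<16 noCarry 0≤
      inv = invariant (suc n) (s≤s z≤n) k′ (proj₁ step)
      lastEdge = lastEdges s r<16
      digits≡ : digits 16 (r + suc n * 16) ≡ digits 16 (suc n) ++ [ r ]
      digits≡ = digits-snoc 16 1<16 (suc n) r r<16 (≤-trans (s≤s z≤n) (m≤n+m (suc n * 16) r))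
      lower : least ℤ.≤ value noCarry (r + suc n * 16)
      lower = ℤₚ.≤-trans (proj₁ lastEdge)
        (subst (propagated s r noCarry ℤ.≤_) (sym (proj₂ step)) (lift-≤ 16 c (proj₁ inv)))
      attained⇒extremal : value noCarry (r + suc n * 16) ≡ least → Extremal (r + suc n * 16)
      attained⇒extremal value≡ =
        suc (proj₁ repdigit) , trans digits≡ (cong₂ (λ xs x → xs ++ [ x ]) (proj₂ repdigit) (proj₂ previous))
        where
        attained : propagated s r noCarry ≡ least × value k′ (suc n) ≡ bound s k′
        attained = squeeze 16 c (proj₁ inv) (proj₁ lastEdge) (trans (sym (proj₂ step)) value≡)
        previous : T (tight s k′) × r ≡ lastDigit
        previous = proj₂ lastEdge (proj₁ attained)
        repdigit : Repdigit (suc n)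
        repdigit = proj₂ inv (proj₁ previous) (proj₂ attained)
      extremal⇒attained : Extremal (r + suc n * 16) → value noCarry (r + suc n * 16) ≡ least
      extremal⇒attained (j , e) =
        attained j (∷ʳ-injective (digits 16 (suc n)) (replicate j loopDigit) (trans (sym digits≡) e))
        where
        attained : ∀ j → digits 16 (suc n) ≡ replicate j loopDigit × r ≡ lastDigit →
                   value noCarry (r + suc n * 16) ≡ least
        attained zero    (prefix , _)    = ⊥-elim (0≢1+n (sym (digits≡[]⇒≡0 16 1<16 (suc n) prefix)))
        attained (suc i) (prefix , refl) =
          trans (value-after-loop (suc n) r<16 noCarry (repdigit-value i (suc n) prefix) carry-last 0≤) propagate-last

    least-bound : ∀ n → 2 ≤ n → LeastBound n
    least-bound n 2≤n = subst LeastBound (sym n≡) (least-bound-snoc (n div 16) (m%n<n n 16) (subst (2 ≤_) n≡ 2≤n))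
      where
      n≡ : n ≡ n % 16 + n div 16 * 16
      n≡ = m≡m%n+[m/n]*n n 16

lower-certificate : Certificate
lower-certificate = record
  { α = + 176 ; β = + 47
  ; bound = λ s k → lookup (lookup Tables.lower-table s) k
  ; tight = λ s k → does (s Fin.≟ # 10) ∧ does (toℕ k ≤? 1)
  ; loopDigit = 11 ; lastDigit = 12 ; least = + 140
  ; loopState = # 10 ; loopCarry = # 0
  }

upper-certificate : Certificate
upper-certificate = record
  { α = ℤ.- + 4 ; β = ℤ.- + 15
  ; bound = λ s k → lookup (lookup Tables.upper-table s) k
  ; tight = λ s k → does (s Fin.≟ # 7) ∧ does (toℕ k ≟ 3)
  ; loopDigit = 4 ; lastDigit = 5 ; least = + 11
  ; loopState = # 7 ; loopCarry = # 3
  }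

lower-valid : Bounds.Valid lower-certificate
lower-valid = record
  { edges = from-yes edges? ; lastEdges = from-yes lastEdges?
  ; initials = from-yes initials? ; initialLasts = from-yes initialLasts?
  ; loop = record { state-loop = refl ; value-loop = refl ; δ-loop = refl ; carry-loop = refl
                  ; propagate-loop = refl ; carry-last = refl ; propagate-last = refl }
  }
  where open Bounds lower-certificate

upper-valid : Bounds.Valid upper-certificate
upper-valid = record
  { edges = from-yes edges? ; lastEdges = from-yes lastEdges?
  ; initials = from-yes initials? ; initialLasts = from-yes initialLasts?
  ; loop = record { state-loop = refl ; value-loop = refl ; δ-loop = refl ; carry-loop = refl
                  ; propagate-loop = refl ; carry-last = refl ; propagate-last = refl }
  }
  where open Bounds upper-certificate

≤-difference : ∀ a b c → + c ℤ.≤ + a ℤ.- + b → b + c ≤ a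
≤-difference a b c c≤a-b =
  ℤₚ.drop‿+≤+ (subst₂ ℤ._≤_ (sym (ℤₚ.pos-+ b c)) (ring (+ a) (+ b)) (ℤₚ.+-monoʳ-≤ (+ b) c≤a-b))
  where
  ring : ∀ a b → b ℤ.+ (a ℤ.- b) ≡ a
  ring = ℤ-Solver.solve-∀

≡-difference : ∀ a b c → (+ a ℤ.- + b ≡ + c) ⇔ (a ≡ b + c)
≡-difference a b c = mk⇔ to from
  where
  to : + a ℤ.- + b ≡ + c → a ≡ b + c
  to eq = ℤₚ.+-injective (trans (sym (ring₁ (+ a) (+ b))) (trans (cong (λ x → + b ℤ.+ x) eq) (sym (ℤₚ.pos-+ b c))))
    where
    ring₁ : ∀ a b → b ℤ.+ (a ℤ.- b) ≡ a
    ring₁ = ℤ-Solver.solve-∀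
  from : a ≡ b + c → + a ℤ.- + b ≡ + c
  from refl = trans (cong (ℤ._- + b) (ℤₚ.pos-+ b c)) (ring₂ (+ b) (+ c))
    where
    ring₂ : ∀ b c → b ℤ.+ c ℤ.- b ≡ c
    ring₂ = ℤ-Solver.solve-∀

module Lower = Bounds.Theory lower-certificate lower-valid
module Upper = Bounds.Theory upper-certificate upper-valid

Y-noCarry : ∀ {n m} → f n ≡ + m → Y noCarry n ≡ p516 m
Y-noCarry {n} {m} f≡ = trans (cong (λ z → p516 ∣ z ℤ.+ offset noCarry ∣) f≡) (cong p516 (+-identityʳ m))

nonNeg-noCarry : ∀ {n m} → f n ≡ + m → 0ℤ ℤ.≤ f n ℤ.+ offset noCarry
nonNeg-noCarry f≡ = subst (λ z → 0ℤ ℤ.≤ z ℤ.+ offset noCarry) (sym f≡) (ℤ.+≤+ z≤n)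

lower-form : ∀ n y → form (+ 176) (+ 47) n y ≡ + (176 * y) ℤ.- + (47 * n)
lower-form n y = sym (cong₂ ℤ._-_ (ℤₚ.pos-* 176 y) (ℤₚ.pos-* 47 n))

upper-form : ∀ n y → form (ℤ.- + 4) (ℤ.- + 15) n y ≡ + (15 * n) ℤ.- + (4 * y)
upper-form n y = trans (ring (+ y) (+ n)) (sym (cong₂ ℤ._-_ (ℤₚ.pos-* 15 n) (ℤₚ.pos-* 4 y)))
  where
  ring : ∀ y n → ℤ.- + 4 ℤ.* y ℤ.- ℤ.- + 15 ℤ.* n ≡ + 15 ℤ.* n ℤ.- + 4 ℤ.* y
  ring = ℤ-Solver.solve-∀

inHighLang⇔ : ∀ {n} → 2 ≤ n → InHighLang (digits 16 n) ⇔ (∃ λ j → digits 16 n ≡ replicate j 4 ++ [ 5 ])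
inHighLang⇔ {n} 2≤n = mk⇔ to from
  where
  to : InHighLang (digits 16 n) → ∃ λ j → digits 16 n ≡ replicate j 4 ++ [ 5 ]
  to (inj₁ digits≡[1]) = ⊥-elim (<⇒≱ 2≤n (≤-reflexive n≡1))
    where
    unsnoc = digits-unsnoc 16 1<16 n [] 1 digits≡[1]
    n≡1 : n ≡ 1
    n≡1 = trans (m≡m%n+[m/n]*n n 16)
                (cong₂ (λ r q → r + q * 16) (proj₂ unsnoc) (digits≡[]⇒≡0 16 1<16 (n div 16) (proj₁ unsnoc)))
  to (inj₂ (inj₁ e))       = 0 , e
  to (inj₂ (inj₂ (k , e))) = suc k , e
  from : (∃ λ j → digits 16 n ≡ replicate j 4 ++ [ 5 ]) → InHighLang (digits 16 n)
  from (zero  , e) = inj₂ (inj₁ e)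
  from (suc k , e) = inj₂ (inj₂ (k , e))

natural-bound : ∀ {v x y c} {E : Set} → v ≡ + x ℤ.- + y →
                + c ℤ.≤ v × (v ≡ + c ⇔ E) → y + c ≤ x × (x ≡ y + c ⇔ E)
natural-bound {x = x} {y} {c} refl (c≤v , v≡c⇔E) =
  ≤-difference x y c c≤v , v≡c⇔E ⇔-∘ ⇔-sym (≡-difference x y c)

part-a : ∀ (n : ℕ) → 2 ≤ n → ∀ (m : ℕ) → f50 n ≡ + m →
         (47 * n + 140 ≤ 176 * p516 m) × (4 * p516 m + 11 ≤ 15 * n)
         × ((176 * p516 m ≡ 47 * n + 140) ⇔ InLowLang (digits 16 n))
         × ((4 * p516 m + 11 ≡ 15 * n) ⇔ InHighLang (digits 16 n))
part-a n 2≤n m f50≡ =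
  proj₁ low , proj₁ high , proj₂ low , ⇔-sym (inHighLang⇔ 2≤n) ⇔-∘ (proj₂ high ⇔-∘ mk⇔ sym sym)
  where
  f≡ : f n ≡ + m
  f≡ = trans (sym (f50≡f n)) f50≡
  low = natural-bound (trans (cong (form (+ 176) (+ 47) n) (Y-noCarry {n} f≡)) (lower-form n (p516 m)))
                      (Lower.least-bound n 2≤n (nonNeg-noCarry {n} f≡))
  high = natural-bound (trans (cong (form (ℤ.- + 4) (ℤ.- + 15) n) (Y-noCarry {n} f≡)) (upper-form n (p516 m)))
                       (Upper.least-bound n 2≤n (nonNeg-noCarry {n} f≡))

-- Rational exponents

^-distribʳ-* : ∀ a b k → (a * b) ^ k ≡ a ^ k * b ^ k
^-distribʳ-* a b zero    = refl
^-distribʳ-* a b (suc k) = trans (cong (a * b *_) (^-distribʳ-* a b k)) (*-*-comm a b (a ^ k) (b ^ k))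
  where
  *-*-comm : ∀ a b c d → a * b * (c * d) ≡ a * c * (b * d)
  *-*-comm = solve-∀

^-flip : ∀ a m n → (a ^ m) ^ n ≡ (a ^ n) ^ m
^-flip a m n = trans (^-*-assoc a m n) (trans (cong (a ^_) (*-comm m n)) (sym (^-*-assoc a n m)))

^-cancelˡ-< : ∀ {a b} k → a ^ k < b ^ k → a < b
^-cancelˡ-< k aᵏ<bᵏ = ≰⇒> (λ b≤a → <⇒≱ aᵏ<bᵏ (^-monoˡ-≤ k b≤a))

^-cancelʳ-< : ∀ d .{{_ : NonZero d}} {x y} → d ^ x < d ^ y → x < y
^-cancelʳ-< d dˣ<dʸ = ≰⇒> (λ y≤x → <⇒≱ dˣ<dʸ (^-monoʳ-≤ d y≤x))

-- X / Xd ≤ c ^ θ and d ^ θ ≤ Y / Yd for the rational exponent θ = e / (1 + v)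
record Bracket (c X Xd d Y Yd : ℕ) : Set where
  constructor bracket
  field
    e v   : ℕ
    above : X ^ suc v ≤ c ^ e * Xd ^ suc v
    below : d ^ e * Yd ^ suc v ≤ Y ^ suc v

power-shape : ∀ a b Q B V → (a ^ Q * b ^ B) ^ V ≡ (a ^ V) ^ Q * b ^ (B * V)
power-shape a b Q B V = trans (^-distribʳ-* (a ^ Q) (b ^ B) V) (cong₂ _*_ (^-flip a Q V) (^-*-assoc b B V))

scaled-shape : ∀ b e z Q F → (b ^ e * z) ^ Q * b ^ F ≡ b ^ (e * Q + F) * z ^ Q
scaled-shape b e z Q F = begin
  (b ^ e * z) ^ Q * b ^ F       ≡⟨ cong (_* b ^ F) (^-distribʳ-* (b ^ e) z Q) ⟩
  (b ^ e) ^ Q * z ^ Q * b ^ F   ≡⟨ cong (λ x → x * z ^ Q * b ^ F) (^-*-assoc b e Q) ⟩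
  b ^ (e * Q) * z ^ Q * b ^ F   ≡⟨ ring (b ^ (e * Q)) (z ^ Q) (b ^ F) ⟩
  b ^ (e * Q) * b ^ F * z ^ Q   ≡⟨ cong (_* z ^ Q) (^-distribˡ-+-* b (e * Q) F) ⟨
  b ^ (e * Q + F) * z ^ Q       ∎
  where
  open ≡-Reasoning
  ring : ∀ x y w → x * y * w ≡ x * w * y
  ring = solve-∀

-- Raising the hypothesis to the power 1 + v compares exponents of d, hence of c.
bracket-transfer : ∀ {c X Xd d Y Yd} → 1 < c → .{{_ : NonZero d}} → .{{_ : NonZero Xd}} →
                   Bracket c X Xd d Y Yd →
                   ∀ Q A B → Y ^ Q * d ^ B < d ^ A * Yd ^ Q → X ^ Q * c ^ B < c ^ A * Xd ^ Q
bracket-transfer {c} {X} {Xd} {d} {Y} {Yd} 1<c (bracket e v above below) Q A B hyp =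
  ^-cancelˡ-< V (begin-strict
    (X ^ Q * c ^ B) ^ V                  ≡⟨ power-shape X c Q B V ⟩
    (X ^ V) ^ Q * c ^ (B * V)            ≤⟨ *-monoˡ-≤ (c ^ (B * V)) (^-monoˡ-≤ Q above) ⟩
    (c ^ e * Xd ^ V) ^ Q * c ^ (B * V)   ≡⟨ scaled-shape c e (Xd ^ V) Q (B * V) ⟩
    c ^ (e * Q + B * V) * (Xd ^ V) ^ Q   <⟨ *-monoˡ-< ((Xd ^ V) ^ Q) (^-monoʳ-< c 1<c exponent<) ⟩
    c ^ (A * V) * (Xd ^ V) ^ Q           ≡⟨ power-shape′ c Xd A Q ⟨
    (c ^ A * Xd ^ Q) ^ V                 ∎)
  where
  open ≤-Reasoning
  V = suc v
  instance
    _ = m^n≢0 (Xd ^ V) Q {{m^n≢0 Xd V}}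
  power-shape′ : ∀ b z A Q → (b ^ A * z ^ Q) ^ V ≡ b ^ (A * V) * (z ^ V) ^ Q
  power-shape′ b z A Q = trans (^-distribʳ-* (b ^ A) (z ^ Q) V) (cong₂ _*_ (^-*-assoc b A V) (^-flip z Q V))
  exponent< : e * Q + B * V < A * V
  exponent< = ^-cancelʳ-< d (*-cancelʳ-< _ _ _ (begin-strict
    d ^ (e * Q + B * V) * (Yd ^ V) ^ Q   ≡⟨ scaled-shape d e (Yd ^ V) Q (B * V) ⟨
    (d ^ e * Yd ^ V) ^ Q * d ^ (B * V)   ≤⟨ *-monoˡ-≤ (d ^ (B * V)) (^-monoˡ-≤ Q below) ⟩
    (Y ^ V) ^ Q * d ^ (B * V)            ≡⟨ power-shape Y d Q B V ⟨
    (Y ^ Q * d ^ B) ^ V                  <⟨ ^-monoˡ-< V hyp ⟩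
    (d ^ A * Yd ^ Q) ^ V                 ≡⟨ power-shape′ d Yd A Q ⟩
    d ^ (A * V) * (Yd ^ V) ^ Q           ∎))

bracket-shift : ∀ {c X Xd d Y Yd X′ Y′} j → Bracket c X Xd d Y Yd → X′ ≤ c ^ j * X → d ^ j * Y ≤ Y′ →
                Bracket c X′ Xd d Y′ Yd
bracket-shift {c} {X} {Xd} {d} {Y} {Yd} {X′} {Y′} j (bracket e v above below) X′≤ ≤Y′ =
  bracket (j * V + e) v above′ below′
  where
  open ≤-Reasoning
  V = suc v
  power-scaled : ∀ b z → (b ^ j * z) ^ V ≡ b ^ (j * V) * z ^ V
  power-scaled b z = trans (^-distribʳ-* (b ^ j) z V) (cong (_* z ^ V) (^-*-assoc b j V))
  exponent-sum : ∀ b z → b ^ (j * V + e) * z ≡ b ^ (j * V) * (b ^ e * z)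
  exponent-sum b z = trans (cong (_* z) (^-distribˡ-+-* b (j * V) e)) (*-assoc (b ^ (j * V)) (b ^ e) z)
  above′ : X′ ^ V ≤ c ^ (j * V + e) * Xd ^ V
  above′ = begin
    X′ ^ V                           ≤⟨ ^-monoˡ-≤ V X′≤ ⟩
    (c ^ j * X) ^ V                  ≡⟨ power-scaled c X ⟩
    c ^ (j * V) * X ^ V              ≤⟨ *-monoʳ-≤ (c ^ (j * V)) above ⟩
    c ^ (j * V) * (c ^ e * Xd ^ V)   ≡⟨ exponent-sum c (Xd ^ V) ⟨
    c ^ (j * V + e) * Xd ^ V         ∎
  below′ : d ^ (j * V + e) * Yd ^ V ≤ Y′ ^ V
  below′ = begin
    d ^ (j * V + e) * Yd ^ V         ≡⟨ exponent-sum d (Yd ^ V) ⟩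
    d ^ (j * V) * (d ^ e * Yd ^ V)   ≤⟨ *-monoʳ-≤ (d ^ (j * V)) below ⟩
    d ^ (j * V) * Y ^ V              ≡⟨ power-scaled d Y ⟨
    (d ^ j * Y) ^ V                  ≤⟨ ^-monoˡ-≤ V ≤Y′ ⟩
    Y′ ^ V                           ∎

-- Truncation to the leading digits

lower-step : ∀ n {r} → r < 16 → + 5 ℤ.* (+ 4 ℤ.* f n ℤ.- + 7) ℤ.≤ + 4 ℤ.* f (r + n * 16) ℤ.- + 7
lower-step n {r} r<16 = begin
  L                                          ≡⟨ ℤₚ.+-identityʳ L ⟨
  L ℤ.+ (+ 4 ℤ.* ℤ.- + 7 ℤ.+ + 28)           ≤⟨ ℤₚ.+-monoʳ-≤ L (ℤₚ.+-monoˡ-≤ (+ 28) (ℤₚ.*-monoˡ-≤-nonNeg (+ 4) -7≤Δ)) ⟩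
  L ℤ.+ (+ 4 ℤ.* Δ ℤ.+ + 28)                 ≡⟨ ring (f n) Δ ⟩
  + 4 ℤ.* (+ 5 ℤ.* f n ℤ.+ Δ) ℤ.- + 7        ≡⟨ cong (λ x → + 4 ℤ.* x ℤ.- + 7) (f-digit n r<16) ⟨
  + 4 ℤ.* f (r + n * 16) ℤ.- + 7             ∎
  where
  open ℤₚ.≤-Reasoning
  L = + 5 ℤ.* (+ 4 ℤ.* f n ℤ.- + 7)
  Δ = D (state n) r
  -7≤Δ = proj₁ (D-bounded (state n) r<16)
  ring : ∀ F D → + 5 ℤ.* (+ 4 ℤ.* F ℤ.- + 7) ℤ.+ (+ 4 ℤ.* D ℤ.+ + 28) ≡ + 4 ℤ.* (+ 5 ℤ.* F ℤ.+ D) ℤ.- + 7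
  ring = ℤ-Solver.solve-∀

upper-step : ∀ n {r} → r < 16 → + 4 ℤ.* f (r + n * 16) ℤ.+ + 7 ℤ.≤ + 5 ℤ.* (+ 4 ℤ.* f n ℤ.+ + 7)
upper-step n {r} r<16 = begin
  + 4 ℤ.* f (r + n * 16) ℤ.+ + 7             ≡⟨ cong (λ x → + 4 ℤ.* x ℤ.+ + 7) (f-digit n r<16) ⟩
  + 4 ℤ.* (+ 5 ℤ.* f n ℤ.+ Δ) ℤ.+ + 7        ≡⟨ ring (f n) Δ ⟩
  U ℤ.+ (+ 4 ℤ.* Δ ℤ.- + 28)                 ≤⟨ ℤₚ.+-monoʳ-≤ U (ℤₚ.+-monoˡ-≤ (ℤ.- + 28) (ℤₚ.*-monoˡ-≤-nonNeg (+ 4) Δ≤7)) ⟩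
  U ℤ.+ (+ 4 ℤ.* + 7 ℤ.- + 28)               ≡⟨ ℤₚ.+-identityʳ U ⟩
  U                                          ∎
  where
  open ℤₚ.≤-Reasoning
  U = + 5 ℤ.* (+ 4 ℤ.* f n ℤ.+ + 7)
  Δ = D (state n) r
  Δ≤7 = proj₂ (D-bounded (state n) r<16)
  ring : ∀ F D → + 4 ℤ.* (+ 5 ℤ.* F ℤ.+ D) ℤ.+ + 7 ≡ + 5 ℤ.* (+ 4 ℤ.* F ℤ.+ + 7) ℤ.+ (+ 4 ℤ.* D ℤ.- + 28)
  ring = ℤ-Solver.solve-∀

-- a is n cut down to its two leading hexadecimal digits: n = 16 ^ j * a + (j further digits)
record Truncation (n : ℕ) : Set where
  field
    a j     : ℕ
    16≤a    : 16 ≤ a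
    a<256   : a < 256
    prefix≤ : 16 ^ j * a ≤ n
    <prefix : n < 16 ^ j * suc a
    f-lower : + (5 ^ j) ℤ.* (+ 4 ℤ.* f a ℤ.- + 7) ℤ.≤ + 4 ℤ.* f n ℤ.- + 7
    f-upper : + 4 ℤ.* f n ℤ.+ + 7 ℤ.≤ + (5 ^ j) ℤ.* (+ 4 ℤ.* f a ℤ.+ + 7)

truncation-step : ∀ n {r} → r < 16 → Truncation n → Truncation (r + n * 16)
truncation-step n {r} r<16 T = record
  { a = a ; j = suc j ; 16≤a = 16≤a ; a<256 = a<256
  ; prefix≤ = prefix≤′ ; <prefix = <prefix′ ; f-lower = f-lower′ ; f-upper = f-upper′ }
  where
  open Truncation T
  prefix≤′ : 16 ^ suc j * a ≤ r + n * 16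
  prefix≤′ = ≤-trans (≤-reflexive (ring (16 ^ j) a)) (≤-trans (*-monoˡ-≤ 16 prefix≤) (m≤n+m (n * 16) r))
    where
    ring : ∀ p a → 16 * p * a ≡ p * a * 16
    ring = solve-∀
  <prefix′ : r + n * 16 < 16 ^ suc j * suc a
  <prefix′ = <-≤-trans (+-monoˡ-< (n * 16) r<16)
                       (≤-trans (*-monoˡ-≤ 16 <prefix) (≤-reflexive (ring (16 ^ j) (suc a))))
    where
    ring : ∀ p a → p * a * 16 ≡ 16 * p * a
    ring = solve-∀
  5^suc : ∀ W → + (5 ^ suc j) ℤ.* W ≡ + 5 ℤ.* (+ (5 ^ j) ℤ.* W)
  5^suc W = trans (cong (ℤ._* W) (ℤₚ.pos-* 5 (5 ^ j))) (ℤₚ.*-assoc (+ 5) (+ (5 ^ j)) W)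
  f-lower′ : + (5 ^ suc j) ℤ.* (+ 4 ℤ.* f a ℤ.- + 7) ℤ.≤ + 4 ℤ.* f (r + n * 16) ℤ.- + 7
  f-lower′ = ℤₚ.≤-trans (ℤₚ.≤-reflexive (5^suc _))
                        (ℤₚ.≤-trans (ℤₚ.*-monoˡ-≤-nonNeg (+ 5) f-lower) (lower-step n r<16))
  f-upper′ : + 4 ℤ.* f (r + n * 16) ℤ.+ + 7 ℤ.≤ + (5 ^ suc j) ℤ.* (+ 4 ℤ.* f a ℤ.+ + 7)
  f-upper′ = ℤₚ.≤-trans (upper-step n r<16)
                        (ℤₚ.≤-trans (ℤₚ.*-monoˡ-≤-nonNeg (+ 5) f-upper) (ℤₚ.≤-reflexive (sym (5^suc _))))

truncation : ∀ n → 16 ≤ n → Truncation n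
truncation = digit-induction 16 1<16 (λ n → 16 ≤ n → Truncation n) (λ ()) step
  where
  leading : ∀ {n} → 16 ≤ n → n < 256 → Truncation n
  leading {n} 16≤n n<256 = record
    { a = n ; j = 0 ; 16≤a = 16≤n ; a<256 = n<256
    ; prefix≤ = ≤-reflexive (+-identityʳ n) ; <prefix = ≤-reflexive (cong suc (sym (+-identityʳ n)))
    ; f-lower = ℤₚ.≤-reflexive (ℤₚ.*-identityˡ _) ; f-upper = ℤₚ.≤-reflexive (sym (ℤₚ.*-identityˡ _)) }
  step : ∀ {r n} → r < 16 → (16 ≤ n → Truncation n) → 16 ≤ r + n * 16 → Truncation (r + n * 16)
  step {r} {n} r<16 ih 16≤ with 16 ≤? n
  ... | yes 16≤n = truncation-step n r<16 (ih 16≤n)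
  ... | no  16≰n = leading 16≤ (<-≤-trans (+-monoˡ-< (n * 16) r<16) (*-monoˡ-≤ 16 (≰⇒> 16≰n)))

BoundedBracket : (c X Xd d Y Yd : ℕ) → Set
BoundedBracket c X Xd d Y Yd =
  ∃ λ e → e < 8 × ∃ λ v → v < 3 × X ^ suc v ≤ c ^ e * Xd ^ suc v × d ^ e * Yd ^ suc v ≤ Y ^ suc v

bracket? : ∀ c X Xd d Y Yd → Dec (BoundedBracket c X Xd d Y Yd)
bracket? c X Xd d Y Yd =
  anyUpTo? (λ e → anyUpTo? (λ v → X ^ suc v ≤? c ^ e * Xd ^ suc v ×-dec d ^ e * Yd ^ suc v ≤? Y ^ suc v) 3) 8

to-bracket : ∀ {c X Xd d Y Yd} → BoundedBracket c X Xd d Y Yd → Bracket c X Xd d Y Yd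
to-bracket (e , _ , v , _ , above , below) = bracket e v above below

InitialBrackets : ℕ → ℤ → Set
InitialBrackets n z = 0ℤ ℤ.< z
  × BoundedBracket 16 (47 * n + 140) 176 5 (4 * ∣ z ∣) 4
  × BoundedBracket 5 (4 * ∣ z ∣) 4 16 (225 * n ∸ 165) 16

-- For n with leading digits a (see Truncation), 47 (a + 1) + 140 and 225 a − 165 bound
-- 47 n + 140 and 225 n − 165 up to the factor 16 ^ j, and 4 f a ∓ 7 bound 4 f n up to 5 ^ j.
PrefixBrackets : ℕ → ℤ → Set
PrefixBrackets a z = + 7 ℤ.≤ + 4 ℤ.* z
  × BoundedBracket 16 (47 * suc a + 140) 176 5 (4 * ∣ z ∣ ∸ 7) 4
  × BoundedBracket 5 (4 * ∣ z ∣ + 7) 4 16 (225 * a ∸ 165) 16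

-- Matching on z evaluates f a once; otherwise every use of z below would recompute it.
shared : {P : ℤ → Set} → ((z : ℤ) → P z) → (z : ℤ) → P z
shared k (+ zero)     = k (+ zero)
shared k (+ suc n)    = k (+ suc n)
shared k -[1+ zero ]  = k -[1+ zero ]
shared k -[1+ suc n ] = k -[1+ suc n ]

initial-brackets : ∀ {n} → n < 16 → 2 ≤ n → InitialBrackets n (f n)
initial-brackets = from-yes (allUpTo? (λ n → 2 ≤? n →-dec shared (λ z →
  0ℤ ℤ.<? z
  ×-dec bracket? 16 (47 * n + 140) 176 5 (4 * ∣ z ∣) 4
  ×-dec bracket? 5 (4 * ∣ z ∣) 4 16 (225 * n ∸ 165) 16) (f n)) 16)

prefix-brackets : ∀ {a} → a < 256 → 16 ≤ a → PrefixBrackets a (f a)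
prefix-brackets = from-yes (allUpTo? (λ a → 16 ≤? a →-dec shared (λ z →
  + 7 ℤ.≤? + 4 ℤ.* z
  ×-dec bracket? 16 (47 * suc a + 140) 176 5 (4 * ∣ z ∣ ∸ 7) 4
  ×-dec bracket? 5 (4 * ∣ z ∣ + 7) 4 16 (225 * a ∸ 165) 16) (f a)) 256)

positive-of-lower : ∀ x z → + x ℤ.≤ + 4 ℤ.* z ℤ.- + 7 → z ≡ + ∣ z ∣ × 7 + x ≤ 4 * ∣ z ∣
positive-of-lower x (+ m)    x≤ =
  refl , ≤-difference (4 * m) 7 x (subst (λ w → + x ℤ.≤ w ℤ.- + 7) (sym (ℤₚ.pos-* 4 m)) x≤)
positive-of-lower x -[1+ k ] ()

pos-4*+7 : ∀ {z k} → z ≡ + k → + 4 ℤ.* z ℤ.+ + 7 ≡ + (4 * k + 7)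
pos-4*+7 {k = k} refl = sym (trans (ℤₚ.pos-+ (4 * k) 7) (cong (ℤ._+ + 7) (ℤₚ.pos-* 4 k)))

record RootBrackets (n : ℕ) : Set where
  field
    m             : ℕ
    f≡            : f n ≡ + m
    0<m           : 0 < m
    lower-bracket : Bracket 16 (47 * n + 140) 176 5 (4 * m) 4
    upper-bracket : Bracket 5 (4 * m) 4 16 (225 * n ∸ 165) 16

initial-root-brackets : ∀ {n} → n < 16 → 2 ≤ n → RootBrackets n
initial-root-brackets {n} n<16 2≤n = record
  { m = ∣ f n ∣ ; f≡ = f≡ ; 0<m = ℤₚ.drop‿+<+ (subst (0ℤ ℤ.<_) f≡ (proj₁ checked))
  ; lower-bracket = to-bracket (proj₁ (proj₂ checked)) ; upper-bracket = to-bracket (proj₂ (proj₂ checked)) }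
  where
  checked = initial-brackets n<16 2≤n
  f≡ : f n ≡ + ∣ f n ∣
  f≡ = sym (ℤₚ.0≤i⇒+∣i∣≡i (ℤₚ.<⇒≤ (proj₁ checked)))

truncated-root-brackets : ∀ {n} → 16 ≤ n → RootBrackets n
truncated-root-brackets {n} 16≤n = record
  { m = m ; f≡ = proj₁ n-facts ; 0<m = *-cancelˡ-< 4 0 m (<-≤-trans (s≤s z≤n) 7≤4m)
  ; lower-bracket = bracket-shift j (to-bracket (proj₁ (proj₂ checked))) N≤ 5ʲW≤4m
  ; upper-bracket = bracket-shift j (to-bracket (proj₂ (proj₂ checked))) 4m≤5ʲW′ 16ʲX≤ }
  where
  open Truncation (truncation n 16≤n)
  checked = prefix-brackets a<256 16≤a
  mₐ = ∣ f a ∣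
  a-facts = positive-of-lower 0 (f a) (ℤₚ.i≤j⇒0≤j-i (proj₁ checked))
  W = 4 * mₐ ∸ 7
  W≡ : + 4 ℤ.* f a ℤ.- + 7 ≡ + W
  W≡ = begin
    + 4 ℤ.* f a ℤ.- + 7      ≡⟨ cong (λ z → + 4 ℤ.* z ℤ.- + 7) (proj₁ a-facts) ⟩
    + 4 ℤ.* + mₐ ℤ.- + 7     ≡⟨ cong (ℤ._- + 7) (ℤₚ.pos-* 4 mₐ) ⟨
    + (4 * mₐ) ℤ.- + 7       ≡⟨ ℤₚ.m-n≡m⊖n (4 * mₐ) 7 ⟩
    (4 * mₐ) ℤ.⊖ 7           ≡⟨ ℤₚ.⊖-≥ (subst (_≤ 4 * mₐ) (+-identityʳ 7) (proj₂ a-facts)) ⟩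
    + W                      ∎
    where open ≡-Reasoning
  n-facts = positive-of-lower (5 ^ j * W) (f n)
    (subst (ℤ._≤ + 4 ℤ.* f n ℤ.- + 7) (trans (cong (+ (5 ^ j) ℤ.*_) W≡) (sym (ℤₚ.pos-* (5 ^ j) W))) f-lower)
  m = ∣ f n ∣
  7≤4m : 7 ≤ 4 * m
  7≤4m = ≤-trans (m≤m+n 7 _) (proj₂ n-facts)
  5ʲW≤4m : 5 ^ j * W ≤ 4 * m
  5ʲW≤4m = ≤-trans (m≤n+m _ 7) (proj₂ n-facts)
  4m≤5ʲW′ : 4 * m ≤ 5 ^ j * (4 * mₐ + 7)
  4m≤5ʲW′ = ≤-trans (m≤m+n (4 * m) 7) (ℤₚ.drop‿+≤+ (subst₂ ℤ._≤_ (pos-4*+7 (proj₁ n-facts))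
    (trans (cong (+ (5 ^ j) ℤ.*_) (pos-4*+7 (proj₁ a-facts))) (sym (ℤₚ.pos-* (5 ^ j) _))) f-upper))
  instance
    _ = m^n≢0 16 j
  N≤ : 47 * n + 140 ≤ 16 ^ j * (47 * suc a + 140)
  N≤ = ≤-trans (+-mono-≤ (*-monoʳ-≤ 47 (<⇒≤ <prefix)) (m≤m*n 140 (16 ^ j))) (≤-reflexive (ring (16 ^ j) (suc a)))
    where
    ring : ∀ p s → 47 * (p * s) + 140 * p ≡ p * (47 * s + 140)
    ring = solve-∀
  16ʲX≤ : 16 ^ j * (225 * a ∸ 165) ≤ 225 * n ∸ 165
  16ʲX≤ = ≤-trans (≤-reflexive (*-distribˡ-∸ (16 ^ j) (225 * a) 165))
    (∸-mono (≤-trans (≤-reflexive (ring (16 ^ j) a)) (*-monoʳ-≤ 225 prefix≤)) (m≤n*m 165 (16 ^ j)))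
    where
    ring : ∀ p a → p * (225 * a) ≡ 225 * (p * a)
    ring = solve-∀

root-brackets : ∀ n → 2 ≤ n → RootBrackets n
root-brackets n 2≤n with n <? 16
... | yes n<16 = initial-root-brackets n<16 2≤n
... | no  n≮16 = truncated-root-brackets (≮⇒≥ n≮16)

-- Rationals

-- q = A / B, stated without normalising A / B
record IsRatio (q : ℚ) (A B : ℕ) : Set where
  constructor isRatio
  field
    cross : ↥ q ℤ.* + B ≡ + A ℤ.* ↧ q

/-isRatio : ∀ i n .{{_ : NonZero n}} → ↥ (i / n) ℤ.* + n ≡ i ℤ.* ↧ (i / n)
/-isRatio i n = begin
  ↥ (i / n) ℤ.* + n                           ≡⟨ cong (↥ (i / n) ℤ.*_) (ℚₚ.↧-/ i n) ⟨
  ↥ (i / n) ℤ.* (↧ (i / n) ℤ.* gcd i (+ n))   ≡⟨ ring (↥ (i / n)) (↧ (i / n)) (gcd i (+ n)) ⟩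
  ↥ (i / n) ℤ.* gcd i (+ n) ℤ.* ↧ (i / n)     ≡⟨ cong (ℤ._* ↧ (i / n)) (ℚₚ.↥-/ i n) ⟩
  i ℤ.* ↧ (i / n)                             ∎
  where
  open ≡-Reasoning
  ring : ∀ u d g → u ℤ.* (d ℤ.* g) ≡ u ℤ.* g ℤ.* d
  ring = ℤ-Solver.solve-∀

isRatio-/ : ∀ A B .{{_ : NonZero B}} → IsRatio (+ A / B) A B
isRatio-/ A B = isRatio (/-isRatio (+ A) B)

isRatio-* : ∀ {p q A B C D} → IsRatio p A B → IsRatio q C D → IsRatio (p ℚ.* q) (A * C) (B * D)
isRatio-* {p@record{}} {q@record{}} {A} {B} {C} {D} (isRatio p≐) (isRatio q≐) =
  isRatio (ℤₚ.*-cancelʳ-≡ _ _ (↧ p ℤ.* ↧ q) (begin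
    ↥ (p ℚ.* q) ℤ.* + (B * D) ℤ.* (↧ p ℤ.* ↧ q)
      ≡⟨ cong (λ x → ↥ (p ℚ.* q) ℤ.* x ℤ.* (↧ p ℤ.* ↧ q)) (ℤₚ.pos-* B D) ⟩
    ↥ (p ℚ.* q) ℤ.* (+ B ℤ.* + D) ℤ.* (↧ p ℤ.* ↧ q)
      ≡⟨ ring₁ (↥ (p ℚ.* q)) (+ B) (+ D) (↧ p ℤ.* ↧ q) ⟩
    ↥ (p ℚ.* q) ℤ.* (↧ p ℤ.* ↧ q) ℤ.* (+ B ℤ.* + D)
      ≡⟨ cong (ℤ._* (+ B ℤ.* + D)) (/-isRatio (↥ p ℤ.* ↥ q) (ℚ.↧ₙ p * ℚ.↧ₙ q)) ⟩
    ↥ p ℤ.* ↥ q ℤ.* ↧ (p ℚ.* q) ℤ.* (+ B ℤ.* + D)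
      ≡⟨ ring₂ (↥ p) (↥ q) (↧ (p ℚ.* q)) (+ B) (+ D) ⟩
    ↥ p ℤ.* + B ℤ.* (↥ q ℤ.* + D) ℤ.* ↧ (p ℚ.* q)
      ≡⟨ cong₂ (λ x y → x ℤ.* y ℤ.* ↧ (p ℚ.* q)) p≐ q≐ ⟩
    + A ℤ.* ↧ p ℤ.* (+ C ℤ.* ↧ q) ℤ.* ↧ (p ℚ.* q)
      ≡⟨ ring₃ (+ A) (↧ p) (+ C) (↧ q) (↧ (p ℚ.* q)) ⟩
    + A ℤ.* + C ℤ.* ↧ (p ℚ.* q) ℤ.* (↧ p ℤ.* ↧ q)
      ≡⟨ cong (λ x → x ℤ.* ↧ (p ℚ.* q) ℤ.* (↧ p ℤ.* ↧ q)) (ℤₚ.pos-* A C) ⟨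
    + (A * C) ℤ.* ↧ (p ℚ.* q) ℤ.* (↧ p ℤ.* ↧ q)
      ∎))
  where
  open ≡-Reasoning
  ring₁ : ∀ u b d e → u ℤ.* (b ℤ.* d) ℤ.* e ≡ u ℤ.* e ℤ.* (b ℤ.* d)
  ring₁ = ℤ-Solver.solve-∀
  ring₂ : ∀ x y w b d → x ℤ.* y ℤ.* w ℤ.* (b ℤ.* d) ≡ x ℤ.* b ℤ.* (y ℤ.* d) ℤ.* w
  ring₂ = ℤ-Solver.solve-∀
  ring₃ : ∀ a x c y w → a ℤ.* x ℤ.* (c ℤ.* y) ℤ.* w ≡ a ℤ.* c ℤ.* w ℤ.* (x ℤ.* y)
  ring₃ = ℤ-Solver.solve-∀

isRatio-pow : ∀ {q A B} → IsRatio q A B → ∀ k → IsRatio (powℚ q k) (A ^ k) (B ^ k)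
isRatio-pow q≐ zero    = isRatio refl
isRatio-pow q≐ (suc k) = isRatio-* q≐ (isRatio-pow q≐ k)

isRatio-scale : ∀ {q A B} k → IsRatio q A B → IsRatio q (k * A) (k * B)
isRatio-scale {q} {A} {B} k (isRatio q≐) = isRatio (begin
  ↥ q ℤ.* + (k * B)         ≡⟨ cong (↥ q ℤ.*_) (ℤₚ.pos-* k B) ⟩
  ↥ q ℤ.* (+ k ℤ.* + B)     ≡⟨ ring (↥ q) (+ k) (+ B) ⟩
  + k ℤ.* (↥ q ℤ.* + B)     ≡⟨ cong (+ k ℤ.*_) q≐ ⟩
  + k ℤ.* (+ A ℤ.* ↧ q)     ≡⟨ ℤₚ.*-assoc (+ k) (+ A) (↧ q) ⟨
  + k ℤ.* + A ℤ.* ↧ q       ≡⟨ cong (ℤ._* ↧ q) (ℤₚ.pos-* k A) ⟨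
  + (k * A) ℤ.* ↧ q         ∎)
  where
  open ≡-Reasoning
  ring : ∀ u k b → u ℤ.* (k ℤ.* b) ≡ k ℤ.* (u ℤ.* b)
  ring = ℤ-Solver.solve-∀

isRatio-< : ∀ {p q A B C D} → IsRatio p A B → IsRatio q C D → 0 < B → 0 < D → p ℚ.< q ⇔ A * D < C * B
isRatio-< {p@record{}} {q@record{}} {A} {B} {C} {D} (isRatio p≐) (isRatio q≐) (s≤s z≤n) (s≤s z≤n) =
  mk⇔ to from
  where
  scaledˡ : + B ℤ.* + D ℤ.* (↥ p ℤ.* ↧ q) ≡ ↧ p ℤ.* ↧ q ℤ.* (+ A ℤ.* + D)
  scaledˡ = trans (ring₁ (+ B) (+ D) (↥ p) (↧ q))
                  (trans (cong (λ x → x ℤ.* (↧ q ℤ.* + D)) p≐) (ring₂ (+ A) (↧ p) (↧ q) (+ D)))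
    where
    ring₁ : ∀ b d n y → b ℤ.* d ℤ.* (n ℤ.* y) ≡ n ℤ.* b ℤ.* (y ℤ.* d)
    ring₁ = ℤ-Solver.solve-∀
    ring₂ : ∀ a x y d → a ℤ.* x ℤ.* (y ℤ.* d) ≡ x ℤ.* y ℤ.* (a ℤ.* d)
    ring₂ = ℤ-Solver.solve-∀
  scaledʳ : + B ℤ.* + D ℤ.* (↥ q ℤ.* ↧ p) ≡ ↧ p ℤ.* ↧ q ℤ.* (+ C ℤ.* + B)
  scaledʳ = trans (ring₁ (+ B) (+ D) (↥ q) (↧ p))
                  (trans (cong (λ x → x ℤ.* (↧ p ℤ.* + B)) q≐) (ring₂ (+ C) (↧ q) (↧ p) (+ B)))
    where
    ring₁ : ∀ b d n x → b ℤ.* d ℤ.* (n ℤ.* x) ≡ n ℤ.* d ℤ.* (x ℤ.* b)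
    ring₁ = ℤ-Solver.solve-∀
    ring₂ : ∀ c y x b → c ℤ.* y ℤ.* (x ℤ.* b) ≡ x ℤ.* y ℤ.* (c ℤ.* b)
    ring₂ = ℤ-Solver.solve-∀
  to : p ℚ.< q → A * D < C * B
  to (ℚ.*<* p<q) = ℤₚ.drop‿+<+ (subst₂ ℤ._<_ (sym (ℤₚ.pos-* A D)) (sym (ℤₚ.pos-* C B))
    (ℤₚ.*-cancelˡ-<-nonNeg (↧ p ℤ.* ↧ q) (subst₂ ℤ._<_ scaledˡ scaledʳ (ℤₚ.*-monoˡ-<-pos (+ B ℤ.* + D) p<q))))
  from : A * D < C * B → p ℚ.< q
  from AD<CB = ℚ.*<* (ℤₚ.*-cancelˡ-<-nonNeg (+ B ℤ.* + D) (subst₂ ℤ._<_ (sym scaledˡ) (sym scaledʳ)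
    (ℤₚ.*-monoˡ-<-pos (↧ p ℤ.* ↧ q) (subst₂ ℤ._<_ (ℤₚ.pos-* A D) (ℤₚ.pos-* C B) (ℤ.+<+ AD<CB)))))

isRatio-positive : ∀ {x X Xd} → IsRatio x X Xd → 0 < Xd → 0 < X → 0ℚ ℚ.< x
isRatio-positive {X = X} x≐ 0<Xd 0<X =
  Equivalence.from (isRatio-< {A = 0} {B = 1} (isRatio refl) x≐ (s≤s z≤n) 0<Xd) (subst (0 <_) (sym (*-identityʳ X)) 0<X)

power-<⇔ : ∀ {x X Xd} → IsRatio x X Xd → 0 < Xd → ∀ c Q A B →
           powℚ x Q ℚ.* ℕtoℚ (c ^ B) ℚ.< ℕtoℚ (c ^ A) ⇔ X ^ Q * c ^ B < c ^ A * Xd ^ Q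
power-<⇔ {x} {X} {Xd} x≐ 0<Xd c Q A B = mk⇔
  (λ h → subst₂ _<_ (*-identityʳ _) (cong (c ^ A *_) (*-identityʳ _)) (Equivalence.to ratio< h))
  (λ h → Equivalence.from ratio< (subst₂ _<_ (sym (*-identityʳ _)) (cong (c ^ A *_) (sym (*-identityʳ _))) h))
  where
  instance
    _ = >-nonZero 0<Xd
  ratio< = isRatio-< (isRatio-* (isRatio-pow x≐ Q) (isRatio-/ (c ^ B) 1)) (isRatio-/ (c ^ A) 1)
                     (subst (0 <_) (sym (*-identityʳ _)) (m^n>0 Xd Q)) (s≤s z≤n)

part-b : ∀ (n : ℕ) → 2 ≤ n →
         PowαLe (+ (47 * n + 140) / 176) (f50 n / 1) × LePowα (f50 n / 1) (+ (225 * n ∸ 165) / 16)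
part-b n 2≤n = (x-pos , y-pos , lower-transfer) , (x′-pos , y-pos , upper-transfer)
  where
  open RootBrackets (root-brackets n 2≤n)
  y≐ : IsRatio (f50 n / 1) (4 * m) 4
  y≐ = subst (λ z → IsRatio (z / 1) (4 * m) 4) (sym (trans (f50≡f n) f≡)) (isRatio-scale 4 (isRatio-/ m 1))
  x≐ = isRatio-/ (47 * n + 140) 176
  x′≐ = isRatio-/ (225 * n ∸ 165) 16
  y-pos = isRatio-positive y≐ (s≤s z≤n) (*-monoʳ-< 4 0<m)
  x-pos = isRatio-positive x≐ (s≤s z≤n) (≤-trans (s≤s z≤n) (m≤n+m 140 (47 * n)))
  x′-pos = isRatio-positive x′≐ (s≤s z≤n) (≤-trans (s≤s z≤n) (∸-monoˡ-≤ 165 (*-monoʳ-≤ 225 2≤n)))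
  lower-transfer = λ a b q →
    Equivalence.from (power-<⇔ x≐ (s≤s z≤n) 16 (suc q) a b)
    ∘ bracket-transfer 1<16 lower-bracket (suc q) a b
    ∘ Equivalence.to (power-<⇔ y≐ (s≤s z≤n) 5 (suc q) a b)
  upper-transfer = λ a b q →
    Equivalence.from (power-<⇔ y≐ (s≤s z≤n) 5 (suc q) a b)
    ∘ bracket-transfer (s≤s (s≤s z≤n)) upper-bracket (suc q) a b
    ∘ Equivalence.to (power-<⇔ x′≐ (s≤s z≤n) 16 (suc q) a b)

theorem10 : (∀ (n : ℕ) → 2 ≤ n → ∀ (m : ℕ) → f50 n ≡ + m →
                (47 * n + 140 ≤ 176 * p516 m) × (4 * p516 m + 11 ≤ 15 * n)
                × ((176 * p516 m ≡ 47 * n + 140) ⇔ InLowLang (digits 16 n))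
                × ((4 * p516 m + 11 ≡ 15 * n) ⇔ InHighLang (digits 16 n)))
            × (∀ (n : ℕ) → 2 ≤ n →
                PowαLe (+ (47 * n + 140) / 176) (f50 n / 1)
                × LePowα (f50 n / 1) (+ (225 * n ∸ 165) / 16))
theorem10 = part-a , part-b
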